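{- Let $p$ be an odd prime and $q=p^r$, $r\ge1$. Let $a,b,c,d,e,f\in\mathbb{F}_q^\times$ be such that $af=ce$ and $c^2-4ab=0$, and let $\#C_{a,b,c,d,e,f}(\mathbb{F}_q)$ be the number of $(x,y)\in\mathbb{F}_q^2$ with $ay^2+bx^2+cxy=d+ex^2y^2+fx^3y$. For $h,g\in\mathbb{F}_q^\times$ let $E_{h,g}$ be the elliptic curve $y^2=x^3+hx^2+gx$ and $a_q(E_{h,g})=q+1-\#E_{h,g}(\mathbb{F}_q)$ its trace of Frobenius, where $\#E_{h,g}(\mathbb{F}_q)$ counts the $\mathbb{F}_q$-points including the point at infinity. If $h,g\in\mathbb{F}_q^\times$ satisfy $c^2g=h^2de$, then $$\#C_{a,b,c,d,e,f}(\mathbb{F}_q)=q-1-\varphi(-aeh)\,a_q(E_{h,g})-\varphi(-hg)\,a_q(E_{\frac4h,\frac1g})+\left(q\,\delta\!\left(1-\frac{ab}{de}\right)-1\right)(1+\varphi(ae)).$$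
   Context: $\varphi$ is the quadratic character of $\mathbb{F}_q^\times$ extended by $\varphi(0)=0$. For $x\in\mathbb{F}_q$, $\delta(x)=1$ if $x=0$ and $\delta(x)=0$ otherwise. -}

module Defs where

open import Level using (0ℓ)
open import Data.Bool using (Bool; true; false)
open import Data.Nat as ℕ using (ℕ)
open import Data.Integer as ℤ using (ℤ; +_; 0ℤ; 1ℤ; -1ℤ)
open import Data.List using (List; length; filter; map)
open import Data.Nat.ListAction using (sum)
open import Data.List.Membership.Propositional using (_∈_)
open import Data.List.Relation.Unary.Unique.Propositional using (Unique)
open import Data.List.Relation.Unary.Any using (any?)
open import Relation.Nullary using (¬_; Dec; yes; no)
open import Relation.Binary.Definitions using (DecidableEquality)
open import Relation.Binary.PropositionalEquality using (_≡_)
open import Algebra.Structures using (IsCommutativeRing)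

-- The value of _⁻¹ at 0 is unconstrained (it is never used).
record FiniteField : Set₁ where
  infixl 6 _+_ _-_
  infixl 7 _*_
  infix  8 -_
  infix  9 _⁻¹
  infix  4 _≟_
  field
    F          : Set
    _+_ _*_    : F → F → F
    -_         : F → F
    0# 1#      : F
    _⁻¹        : F → F
    isCommutativeRing : IsCommutativeRing _≡_ _+_ _*_ -_ 0# 1#
    0≢1        : ¬ (0# ≡ 1#)
    ⁻¹-inverse : ∀ x → ¬ (x ≡ 0#) → x * x ⁻¹ ≡ 1#
    _≟_        : DecidableEquality F
    elements   : List F
    complete   : ∀ x → x ∈ elements
    unique     : Unique elements

  _-_ : F → F → F
  x - y = x + (- y)

  4# : F
  4# = 1# + 1# + 1# + 1#

  size : ℕ
  size = length elements

module Ops (K : FiniteField) where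
  open FiniteField K

  count2 : (F → F → F) → (F → F → F) → ℕ
  count2 l r = sum (map (λ x → length (filter (λ y → l x y ≟ r x y) elements)) elements)

  φ : F → ℤ
  φ x with x ≟ 0#
  ... | yes _ = 0ℤ
  ... | no _ with any? (λ y → y * y ≟ x) elements
  ...   | yes _ = 1ℤ
  ...   | no _  = -1ℤ

  δ : F → ℤ
  δ x with x ≟ 0#
  ... | yes _ = 1ℤ
  ... | no _  = 0ℤ

  #C : F → F → F → F → F → F → ℕ
  #C a b c d e f =
    count2 (λ x y → a * y * y + b * x * x + c * x * y)
           (λ x y → d + e * x * x * y * y + f * x * x * x * y)

  #E : F → F → ℕ
  #E h g = ℕ.suc (count2 (λ x y → y * y) (λ x y → x * x * x + h * x * x + g * x))

  aq : F → F → ℤ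
  aq h g = (+ size) ℤ.+ 1ℤ ℤ.- (+ #E h g)

-- Since c ≠ 0 and c² = 4ab we have c = 2ak, b = ak² and f = 2ek for k = c/(2a), and the shear
-- y = u − kx turns the equation of C into u²(a − ex²) = d − ek²x⁴.  Counting the u over each x
-- with the quadratic character gives
--   #C = q + (1 + φ(ae))(q δ(1 − ab/(de)) − 1) + Σₓ φ(Q(x²)),   Q(t) = (d − ek²t²)(a − et),
-- and Σₓ φ(Q(x²)) = Σₜ φ(Q(t)) + Σₜ φ(t Q(t)).  An affine change of variable turns the first sum
-- into φ(−aeh) Σₓ φ(x³ − 2hx² + (h² − 4g)x); after t ↦ 1/t, another one turns the second into
-- φ(−hg) Σₓ φ(x³ − (8/h)x² + (16/h² − 4/g)x) − 1.  These cubics define the curves 2-isogenous to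
-- E_{h,g} and E_{4/h,1/g}, so their character sums are −a_q(E_{h,g}) and −a_q(E_{4/h,1/g}).

module Submission where

open import Defs
open import Data.Nat as ℕ using (ℕ; _≤_; _^_; _%_)
open import Data.Nat.Primality using (Prime)
open import Data.Integer as ℤ using (ℤ; +_; 1ℤ)
open import Relation.Nullary using (¬_)
open import Relation.Binary.PropositionalEquality using (_≡_)

open import Level using (0ℓ)
open import Data.Nat using (zero; suc; z≤n)
import Data.Nat.Properties as ℕP
open import Data.Integer using (-[1+_]; _⊖_; 0ℤ; -1ℤ)
import Data.Integer.Properties as ℤP
open import Data.Integer.Tactic.RingSolver using (solve-∀)
open import Data.Sign as Sign using (Sign)
open import Data.Maybe using (Maybe; just; nothing)
open import Data.Product using (proj₁; proj₂)
open import Data.Sum using (_⊎_; inj₁; inj₂; [_,_]′)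
open import Data.List using (List; []; _∷_; length; filter; map)
open import Data.Nat.ListAction using (sum)
open import Data.List.Membership.Propositional using (_∈_; _∉_; lose)
open import Data.List.Relation.Unary.Any using (here; there; any?; satisfied)
import Data.List.Relation.Unary.All as All
open import Data.List.Relation.Unary.AllPairs using (_∷_)
open import Data.List.Relation.Unary.Unique.Propositional using (Unique)
open import Relation.Nullary using (yes; no; contradiction)
open import Relation.Binary.PropositionalEquality using (_≢_; refl; sym; trans; cong; cong₂; module ≡-Reasoning)
open import Algebra.Bundles using (CommutativeRing)
import Algebra.Solver.Ring.AlmostCommutativeRing as ACR

-- Tactic.RingSolver normalises coefficients inside K itself, where 1# + - 1# does not reduce to 0#
-- for an abstract field, so Algebra.Solver.Ring is instantiated with integer coefficients instead.
module FieldRingSolver (K : FiniteField) where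
  open FiniteField K

  commutativeRing : CommutativeRing 0ℓ 0ℓ
  commutativeRing = record { isCommutativeRing = isCommutativeRing }

  open CommutativeRing commutativeRing
    using (+-congˡ; +-comm; +-identityˡ; +-identityʳ; *-identityˡ; *-identityʳ; zeroʳ; -‿inverseʳ;
           ring; semiring; +-commutativeSemigroup; *-commutativeSemigroup)
  open import Algebra.Properties.Ring ring using (-‿involutive; -0#≈0#; -‿+-comm; -1*x≈-x)
  open import Algebra.Properties.CommutativeSemigroup +-commutativeSemigroup using () renaming (interchange to +-interchange)
  open import Algebra.Properties.CommutativeSemigroup *-commutativeSemigroup using () renaming (interchange to *-interchange)
  open import Algebra.Properties.Semiring.Mult.TCOptimised semiring using (_×_; ×-homo-+; ×1-homo-*)
  open ≡-Reasoning

  fromℤ : ℤ → F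
  fromℤ (ℤ.+ n)    = n × 1#
  fromℤ -[1+ n ] = - (suc n × 1#)

  private
    suc×1 : ∀ n → suc n × 1# ≡ 1# + n × 1#
    suc×1 = ×-homo-+ 1# 1

    [z+x]-[z+y] : ∀ z x y → (z + x) - (z + y) ≡ x - y
    [z+x]-[z+y] z x y = begin
      (z + x) + - (z + y)     ≡⟨ +-congˡ (sym (-‿+-comm z y)) ⟩
      (z + x) + (- z + - y)   ≡⟨ +-interchange z x (- z) (- y) ⟩
      (z + - z) + (x - y)     ≡⟨ cong (_+ (x - y)) (-‿inverseʳ z) ⟩
      0# + (x - y)            ≡⟨ +-identityˡ _ ⟩
      x - y                   ∎

    ⊖-homo : ∀ m n → fromℤ (m ⊖ n) ≡ m × 1# - n × 1#
    ⊖-homo m       zero    = sym (trans (+-congˡ -0#≈0#) (+-identityʳ _))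
    ⊖-homo zero    (suc n) = sym (+-identityˡ _)
    ⊖-homo (suc m) (suc n) = begin
      fromℤ (suc m ⊖ suc n)           ≡⟨ cong fromℤ (ℤP.[1+m]⊖[1+n]≡m⊖n m n) ⟩
      fromℤ (m ⊖ n)                   ≡⟨ ⊖-homo m n ⟩
      m × 1# - n × 1#                 ≡⟨ sym ([z+x]-[z+y] 1# _ _) ⟩
      (1# + m × 1#) - (1# + n × 1#)   ≡⟨ sym (cong₂ _-_ (suc×1 m) (suc×1 n)) ⟩
      suc m × 1# - suc n × 1#         ∎

    +-homo : ∀ i j → fromℤ (i ℤ.+ j) ≡ fromℤ i + fromℤ j
    +-homo (ℤ.+ m)    (ℤ.+ n)    = ×-homo-+ 1# m n
    +-homo (ℤ.+ m)    -[1+ n ] = ⊖-homo m (suc n)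
    +-homo -[1+ m ] (ℤ.+ n)    = trans (⊖-homo n (suc m)) (+-comm _ _)
    +-homo -[1+ m ] -[1+ n ] = begin
      - (suc (suc (m ℕ.+ n)) × 1#)      ≡⟨ cong (λ k → - (suc k × 1#)) (sym (ℕP.+-suc m n)) ⟩
      - ((suc m ℕ.+ suc n) × 1#)        ≡⟨ cong -_ (×-homo-+ 1# (suc m) (suc n)) ⟩
      - (suc m × 1# + suc n × 1#)       ≡⟨ sym (-‿+-comm _ _) ⟩
      - (suc m × 1#) + - (suc n × 1#)   ∎

    sign : Sign → F
    sign Sign.+ = 1#
    sign Sign.- = - 1#

    sign-* : ∀ s t → sign (s Sign.* t) ≡ sign s * sign t
    sign-* Sign.+ t       = sym (*-identityˡ _)
    sign-* Sign.- Sign.+ = sym (*-identityʳ _)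
    sign-* Sign.- Sign.- = sym (trans (-1*x≈-x (- 1#)) (-‿involutive 1#))

    ◃-homo : ∀ s n → fromℤ (s ℤ.◃ n) ≡ sign s * (n × 1#)
    ◃-homo s       zero    = sym (zeroʳ _)
    ◃-homo Sign.+ (suc n) = sym (*-identityˡ _)
    ◃-homo Sign.- (suc n) = sym (-1*x≈-x _)

    sign*abs : ∀ i → fromℤ i ≡ sign (ℤ.sign i) * (ℤ.∣ i ∣ × 1#)
    sign*abs (ℤ.+ n)    = sym (*-identityˡ _)
    sign*abs -[1+ n ] = sym (-1*x≈-x _)

    *-homo : ∀ i j → fromℤ (i ℤ.* j) ≡ fromℤ i * fromℤ j
    *-homo i j = begin
      fromℤ (i ℤ.* j)                                         ≡⟨ ◃-homo (ℤ.sign i Sign.* ℤ.sign j) (∣i∣ ℕ.* ∣j∣) ⟩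
      sign (ℤ.sign i Sign.* ℤ.sign j) * ((∣i∣ ℕ.* ∣j∣) × 1#)  ≡⟨ cong₂ _*_ (sign-* (ℤ.sign i) (ℤ.sign j)) (×1-homo-* ∣i∣ ∣j∣) ⟩
      (sign (ℤ.sign i) * sign (ℤ.sign j)) * ((∣i∣ × 1#) * (∣j∣ × 1#))  ≡⟨ *-interchange _ _ _ _ ⟩
      (sign (ℤ.sign i) * (∣i∣ × 1#)) * (sign (ℤ.sign j) * (∣j∣ × 1#))  ≡⟨ sym (cong₂ _*_ (sign*abs i) (sign*abs j)) ⟩
      fromℤ i * fromℤ j                                         ∎
      where
      ∣i∣ = ℤ.∣ i ∣
      ∣j∣ = ℤ.∣ j ∣

    -‿homo : ∀ i → fromℤ (ℤ.- i) ≡ - fromℤ i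
    -‿homo (ℤ.+ zero)  = sym -0#≈0#
    -‿homo (ℤ.+ suc n) = refl
    -‿homo -[1+ n ] = sym (-‿involutive _)

  almostCommutativeRing : ACR.AlmostCommutativeRing 0ℓ 0ℓ
  almostCommutativeRing = ACR.fromCommutativeRing commutativeRing

  fromℤ-homomorphism : ℤ.+-*-rawRing ACR.-Raw-AlmostCommutative⟶ almostCommutativeRing
  fromℤ-homomorphism = record
    { ⟦_⟧ = fromℤ ; +-homo = +-homo ; *-homo = *-homo ; -‿homo = -‿homo ; 0-homo = refl ; 1-homo = refl }

  fromℤ-≟ : ∀ i j → Maybe (fromℤ i ≡ fromℤ j)
  fromℤ-≟ i j with i ℤ.≟ j
  ... | yes refl = just refl
  ... | no _     = nothing

  open import Algebra.Solver.Ring ℤ.+-*-rawRing almostCommutativeRing fromℤ-homomorphism fromℤ-≟ public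

  -- Built from 1ₚ so that ⟦ 2ₚ ⟧ and ⟦ 4ₚ ⟧ are definitionally 1# + 1# and Defs' 4#.
  0ₚ 1ₚ 2ₚ 4ₚ : ∀ {n} → Polynomial n
  0ₚ = con (ℤ.+ 0)
  1ₚ = con (ℤ.+ 1)
  2ₚ = 1ₚ :+ 1ₚ
  4ₚ = 1ₚ :+ 1ₚ :+ 1ₚ :+ 1ₚ

module FieldProperties (K : FiniteField) where
  open FiniteField K
  open FieldRingSolver K using (commutativeRing; solve; _:=_; _:+_; _:-_; _:*_; 2ₚ; 4ₚ)
  open CommutativeRing commutativeRing
    using (+-congˡ; +-identityˡ; +-identityʳ; *-assoc; *-comm; *-identityˡ; *-identityʳ; zeroˡ; zeroʳ; -‿inverseʳ; ring)
  open import Algebra.Properties.Ring ring using (-‿involutive; -0#≈0#)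
  open import Algebra.Properties.Ring ring public
    using () renaming (x∙y⁻¹≈ε⇒x≈y to x-y≡0⇒x≡y; x≈y⇒x∙y⁻¹≈ε to x≡y⇒x-y≡0)
  open ≡-Reasoning

  1≢0 : 1# ≢ 0#
  1≢0 1≡0 = 0≢1 (sym 1≡0)

  2# : F
  2# = 1# + 1#

  2#*2#≡4# : 2# * 2# ≡ 4#
  2#*2#≡4# = solve 0 (2ₚ :* 2ₚ := 4ₚ) refl

  ⁻¹-inverseˡ : ∀ {x} → x ≢ 0# → x ⁻¹ * x ≡ 1#
  ⁻¹-inverseˡ {x} x≢0 = trans (*-comm _ _) (⁻¹-inverse x x≢0)

  x*[y*y⁻¹]≡x : ∀ x {y} → y ≢ 0# → x * (y * y ⁻¹) ≡ x
  x*[y*y⁻¹]≡x x {y} y≢0 = trans (cong (x *_) (⁻¹-inverse y y≢0)) (*-identityʳ x)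

  *-cancelˡ-≡ : ∀ {c x y} → c ≢ 0# → c * x ≡ c * y → x ≡ y
  *-cancelˡ-≡ {c} {x} {y} c≢0 cx≡cy = begin
    x                ≡⟨ sym (*-identityˡ x) ⟩
    1# * x           ≡⟨ cong (_* x) (sym (⁻¹-inverseˡ c≢0)) ⟩
    c ⁻¹ * c * x     ≡⟨ *-assoc _ _ _ ⟩
    c ⁻¹ * (c * x)   ≡⟨ cong (c ⁻¹ *_) cx≡cy ⟩
    c ⁻¹ * (c * y)   ≡⟨ sym (*-assoc _ _ _) ⟩
    c ⁻¹ * c * y     ≡⟨ cong (_* y) (⁻¹-inverseˡ c≢0) ⟩
    1# * y           ≡⟨ *-identityˡ y ⟩
    y                ∎

  x*y≡0⇒x≡0⊎y≡0 : ∀ {x y} → x * y ≡ 0# → x ≡ 0# ⊎ y ≡ 0#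
  x*y≡0⇒x≡0⊎y≡0 {x} {y} xy≡0 with x ≟ 0#
  ... | yes x≡0 = inj₁ x≡0
  ... | no  x≢0 = inj₂ (*-cancelˡ-≡ x≢0 (trans xy≡0 (sym (zeroʳ x))))

  *-≢0 : ∀ {x y} → x ≢ 0# → y ≢ 0# → x * y ≢ 0#
  *-≢0 x≢0 y≢0 xy≡0 with x*y≡0⇒x≡0⊎y≡0 xy≡0
  ... | inj₁ x≡0 = x≢0 x≡0
  ... | inj₂ y≡0 = y≢0 y≡0

  x*x≡0⇒x≡0 : ∀ {x} → x * x ≡ 0# → x ≡ 0#
  x*x≡0⇒x≡0 xx≡0 with x*y≡0⇒x≡0⊎y≡0 xx≡0
  ... | inj₁ x≡0 = x≡0
  ... | inj₂ x≡0 = x≡0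

  ⁻¹-≢0 : ∀ {x} → x ≢ 0# → x ⁻¹ ≢ 0#
  ⁻¹-≢0 {x} x≢0 x⁻¹≡0 = 0≢1 (begin
    0#          ≡⟨ sym (zeroʳ x) ⟩
    x * 0#      ≡⟨ cong (x *_) (sym x⁻¹≡0) ⟩
    x * x ⁻¹    ≡⟨ ⁻¹-inverse x x≢0 ⟩
    1#          ∎)

  -‿≢0 : ∀ {x} → x ≢ 0# → - x ≢ 0#
  -‿≢0 {x} x≢0 -x≡0 = x≢0 (trans (sym (-‿involutive x)) (trans (cong -_ -x≡0) -0#≈0#))

  ⁻¹-involutive : ∀ {x} → x ≢ 0# → x ⁻¹ ⁻¹ ≡ x
  ⁻¹-involutive {x} x≢0 = *-cancelˡ-≡ (⁻¹-≢0 x≢0) (trans (⁻¹-inverse _ (⁻¹-≢0 x≢0)) (sym (⁻¹-inverseˡ x≢0)))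

  x*x≡y*y⇒x≡y⊎x≡-y : ∀ {x y} → x * x ≡ y * y → x ≡ y ⊎ x ≡ - y
  x*x≡y*y⇒x≡y⊎x≡-y {x} {y} xx≡yy with x*y≡0⇒x≡0⊎y≡0 (trans (difference-of-squares x y) (x≡y⇒x-y≡0 xx≡yy))
    where
    difference-of-squares : ∀ x y → (x - y) * (x + y) ≡ x * x - y * y
    difference-of-squares = solve 2 (λ x y → (x :- y) :* (x :+ y) := x :* x :- y :* y) refl
  ... | inj₁ x-y≡0 = inj₁ (x-y≡0⇒x≡y x y x-y≡0)
  ... | inj₂ x+y≡0 = inj₂ (x-y≡0⇒x≡y x (- y) (trans (+-congˡ (-‿involutive y)) x+y≡0))

module FieldSums (K : FiniteField) where
  open FiniteField K
  open Ops K using (count2; δ)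
  open FieldRingSolver K using (commutativeRing; solve; _:=_; _:+_; _:-_; _:*_; 1ₚ)
  open FieldProperties K
  open CommutativeRing commutativeRing using (+-congˡ; *-identityˡ; zeroʳ)
  open ≡-Reasoning

  [_≡_] : F → F → ℤ
  [ x ≡ y ] with x ≟ y
  ... | yes _ = 1ℤ
  ... | no  _ = 0ℤ

  [≡]-yes : ∀ {x y} → x ≡ y → [ x ≡ y ] ≡ 1ℤ
  [≡]-yes {x} {y} x≡y with x ≟ y
  ... | yes _   = refl
  ... | no  x≢y = contradiction x≡y x≢y

  [≡]-no : ∀ {x y} → x ≢ y → [ x ≡ y ] ≡ 0ℤ
  [≡]-no {x} {y} x≢y with x ≟ y
  ... | yes x≡y = contradiction x≡y x≢y
  ... | no  _   = refl

  [≡]-cong : ∀ {x y x′ y′} → (x ≡ y → x′ ≡ y′) → (x′ ≡ y′ → x ≡ y) → [ x ≡ y ] ≡ [ x′ ≡ y′ ]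
  [≡]-cong {x} {y} to from with x ≟ y
  ... | yes x≡y = sym ([≡]-yes (to x≡y))
  ... | no  x≢y = sym ([≡]-no (λ x′≡y′ → x≢y (from x′≡y′)))

  [≡]-sym : ∀ x y → [ x ≡ y ] ≡ [ y ≡ x ]
  [≡]-sym x y = [≡]-cong sym sym

  [≡]-by-scaled-difference : ∀ {c x y x′ y′} → c ≢ 0# → c * (x - y) ≡ x′ - y′ → [ x ≡ y ] ≡ [ x′ ≡ y′ ]
  [≡]-by-scaled-difference {c} {x} {y} {x′} {y′} c≢0 eq = [≡]-cong
    (λ x≡y → x-y≡0⇒x≡y x′ y′ (begin
      x′ - y′       ≡⟨ sym eq ⟩
      c * (x - y)   ≡⟨ cong (c *_) (x≡y⇒x-y≡0 x≡y) ⟩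
      c * 0#        ≡⟨ zeroʳ c ⟩
      0#            ∎))
    (λ x′≡y′ → x-y≡0⇒x≡y x y (*-cancelˡ-≡ c≢0 (trans eq (trans (x≡y⇒x-y≡0 x′≡y′) (sym (zeroʳ c))))))

  [≡]-by-difference : ∀ {x y x′ y′} → x - y ≡ x′ - y′ → [ x ≡ y ] ≡ [ x′ ≡ y′ ]
  [≡]-by-difference eq = [≡]-by-scaled-difference 1≢0 (trans (*-identityˡ _) eq)

  [≡]*-cong : ∀ {x y} {m n : ℤ} → (x ≡ y → m ≡ n) → [ x ≡ y ] ℤ.* m ≡ [ x ≡ y ] ℤ.* n
  [≡]*-cong {x} {y} m≡n with x ≟ y
  ... | yes x≡y = cong (1ℤ ℤ.*_) (m≡n x≡y)
  ... | no  _   = refl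

  δ≡[≡0] : ∀ x → δ x ≡ [ x ≡ 0# ]
  δ≡[≡0] x with x ≟ 0#
  ... | yes _ = refl
  ... | no  _ = refl

  sumOver : List F → (F → ℤ) → ℤ
  sumOver []       f = 0ℤ
  sumOver (x ∷ xs) f = f x ℤ.+ sumOver xs f

  ∑ : (F → ℤ) → ℤ
  ∑ = sumOver elements

  infixl 10 ∑
  syntax ∑ (λ x → e) = ∑[ x ] e

  ∑-cong : ∀ {f g} → (∀ x → f x ≡ g x) → ∑ f ≡ ∑ g
  ∑-cong {f} {g} f≗g = go elements
    where
    go : ∀ xs → sumOver xs f ≡ sumOver xs g
    go []       = refl
    go (x ∷ xs) = cong₂ ℤ._+_ (f≗g x) (go xs)

  ∑-+ : ∀ (f g : F → ℤ) → ∑[ x ] (f x ℤ.+ g x) ≡ ∑ f ℤ.+ ∑ g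
  ∑-+ f g = go elements
    where
    interchange : ∀ a b c d → (a ℤ.+ b) ℤ.+ (c ℤ.+ d) ≡ (a ℤ.+ c) ℤ.+ (b ℤ.+ d)
    interchange = solve-∀
    go : ∀ xs → sumOver xs (λ x → f x ℤ.+ g x) ≡ sumOver xs f ℤ.+ sumOver xs g
    go []       = refl
    go (x ∷ xs) = trans (cong (λ s → f x ℤ.+ g x ℤ.+ s) (go xs)) (interchange (f x) (g x) _ _)

  ∑-- : ∀ (f g : F → ℤ) → ∑[ x ] (f x ℤ.- g x) ≡ ∑ f ℤ.- ∑ g
  ∑-- f g = go elements
    where
    regroup : ∀ a b c d → (a ℤ.- b) ℤ.+ (c ℤ.- d) ≡ (a ℤ.+ c) ℤ.- (b ℤ.+ d)
    regroup = solve-∀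
    go : ∀ xs → sumOver xs (λ x → f x ℤ.- g x) ≡ sumOver xs f ℤ.- sumOver xs g
    go []       = refl
    go (x ∷ xs) = trans (cong (λ s → f x ℤ.- g x ℤ.+ s) (go xs)) (regroup (f x) (g x) _ _)

  ∑-*ˡ : ∀ c (f : F → ℤ) → ∑[ x ] (c ℤ.* f x) ≡ c ℤ.* ∑ f
  ∑-*ˡ c f = go elements
    where
    go : ∀ xs → sumOver xs (λ x → c ℤ.* f x) ≡ c ℤ.* sumOver xs f
    go []       = sym (ℤP.*-zeroʳ c)
    go (x ∷ xs) = trans (cong (λ s → c ℤ.* f x ℤ.+ s) (go xs)) (sym (ℤP.*-distribˡ-+ c (f x) _))

  ∑-*ʳ : ∀ c (f : F → ℤ) → ∑[ x ] (f x ℤ.* c) ≡ ∑ f ℤ.* c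
  ∑-*ʳ c f = trans (∑-cong (λ x → ℤP.*-comm (f x) c)) (trans (∑-*ˡ c f) (ℤP.*-comm c (∑ f)))

  ∑-const : ∀ c → ∑[ x ] c ≡ + size ℤ.* c
  ∑-const c = go elements
    where
    go : ∀ xs → sumOver xs (λ _ → c) ≡ + length xs ℤ.* c
    go []       = refl
    go (x ∷ xs) = begin
      c ℤ.+ sumOver xs (λ _ → c)       ≡⟨ cong₂ ℤ._+_ (sym (ℤP.*-identityˡ c)) (go xs) ⟩
      1ℤ ℤ.* c ℤ.+ + length xs ℤ.* c   ≡⟨ sym (ℤP.*-distribʳ-+ c 1ℤ (+ length xs)) ⟩
      + length (x ∷ xs) ℤ.* c          ∎

  ∑-comm : ∀ (f : F → F → ℤ) → ∑[ x ] ∑[ y ] f x y ≡ ∑[ y ] ∑[ x ] f x y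
  ∑-comm f = go elements
    where
    go : ∀ xs → sumOver xs (λ x → ∑ (f x)) ≡ ∑[ y ] sumOver xs (λ x → f x y)
    go []       = sym (trans (∑-const 0ℤ) (ℤP.*-zeroʳ (+ size)))
    go (x ∷ xs) = trans (cong (λ s → ∑ (f x) ℤ.+ s) (go xs)) (sym (∑-+ (f x) (λ y → sumOver xs (λ x → f x y))))

  ∑-[≡]-* : ∀ (f : F → ℤ) z → ∑[ y ] ([ y ≡ z ] ℤ.* f y) ≡ f z
  ∑-[≡]-* f z = present elements unique (complete z)
    where
    absent : ∀ xs → z ∉ xs → sumOver xs (λ y → [ y ≡ z ] ℤ.* f y) ≡ 0ℤ
    absent []       _   = refl
    absent (x ∷ xs) z∉ = cong₂ ℤ._+_ (cong (ℤ._* f x) ([≡]-no (λ x≡z → z∉ (here (sym x≡z)))))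
                                     (absent xs (λ z∈ → z∉ (there z∈)))
    present : ∀ xs → Unique xs → z ∈ xs → sumOver xs (λ y → [ y ≡ z ] ℤ.* f y) ≡ f z
    present (x ∷ xs) (x∉xs ∷ _) (here refl) = begin
      [ x ≡ x ] ℤ.* f x ℤ.+ sumOver xs (λ y → [ y ≡ x ] ℤ.* f y)
        ≡⟨ cong₂ ℤ._+_ (cong (ℤ._* f x) ([≡]-yes refl)) (absent xs (λ x∈ → All.lookup x∉xs x∈ refl)) ⟩
      1ℤ ℤ.* f x ℤ.+ 0ℤ
        ≡⟨ trans (ℤP.+-identityʳ _) (ℤP.*-identityˡ (f x)) ⟩
      f x ∎
    present (x ∷ xs) (x∉xs ∷ u) (there z∈) = begin
      [ x ≡ z ] ℤ.* f x ℤ.+ sumOver xs (λ y → [ y ≡ z ] ℤ.* f y)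
        ≡⟨ cong₂ ℤ._+_ (cong (ℤ._* f x) ([≡]-no (All.lookup x∉xs z∈))) (present xs u z∈) ⟩
      0ℤ ℤ.* f x ℤ.+ f z
        ≡⟨ ℤP.+-identityˡ (f z) ⟩
      f z ∎

  ∑-[≡] : ∀ z → ∑[ y ] [ y ≡ z ] ≡ 1ℤ
  ∑-[≡] z = trans (∑-cong (λ y → sym (ℤP.*-identityʳ [ y ≡ z ]))) (∑-[≡]-* (λ _ → 1ℤ) z)

  ∑-fibres : ∀ (σ : F → F) (G : F → ℤ) → ∑[ x ] G (σ x) ≡ ∑[ t ] (G t ℤ.* ∑[ x ] [ σ x ≡ t ])
  ∑-fibres σ G = begin
    ∑[ x ] G (σ x)                            ≡⟨ ∑-cong (λ x → sym (∑-[≡]-* G (σ x))) ⟩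
    ∑[ x ] ∑[ t ] ([ t ≡ σ x ] ℤ.* G t)       ≡⟨ ∑-comm (λ x t → [ t ≡ σ x ] ℤ.* G t) ⟩
    ∑[ t ] ∑[ x ] ([ t ≡ σ x ] ℤ.* G t)       ≡⟨ ∑-cong (λ t → ∑-*ʳ (G t) (λ x → [ t ≡ σ x ])) ⟩
    ∑[ t ] (∑[ x ] [ t ≡ σ x ] ℤ.* G t)
      ≡⟨ ∑-cong (λ t → trans (ℤP.*-comm _ (G t)) (cong (G t ℤ.*_) (∑-cong (λ x → [≡]-sym t (σ x))))) ⟩
    ∑[ t ] (G t ℤ.* ∑[ x ] [ σ x ≡ t ])       ∎

  ∑-reindex : ∀ (σ τ : F → F) → (∀ x → τ (σ x) ≡ x) → (∀ y → σ (τ y) ≡ y) →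
              ∀ (G : F → ℤ) → ∑[ x ] G (σ x) ≡ ∑ G
  ∑-reindex σ τ τσ≗id στ≗id G = trans (∑-fibres σ G) (∑-cong (λ t → begin
    G t ℤ.* ∑[ x ] [ σ x ≡ t ]    ≡⟨ cong (G t ℤ.*_) (∑-cong (λ x → [≡]-cong (σx≡t⇒x≡τt x) (x≡τt⇒σx≡t x))) ⟩
    G t ℤ.* ∑[ x ] [ x ≡ τ t ]    ≡⟨ cong (G t ℤ.*_) (∑-[≡] (τ t)) ⟩
    G t ℤ.* 1ℤ                    ≡⟨ ℤP.*-identityʳ (G t) ⟩
    G t                           ∎))
    where
    σx≡t⇒x≡τt : ∀ {t} x → σ x ≡ t → x ≡ τ t
    σx≡t⇒x≡τt x refl = sym (τσ≗id x)
    x≡τt⇒σx≡t : ∀ {t} x → x ≡ τ t → σ x ≡ t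
    x≡τt⇒σx≡t x refl = στ≗id _

  ∑-affine : ∀ {m} → m ≢ 0# → ∀ t (G : F → ℤ) → ∑[ x ] G (t + m * x) ≡ ∑ G
  ∑-affine {m} m≢0 t = ∑-reindex (λ x → t + m * x) (λ y → (y - t) * m ⁻¹) τσ≗id στ≗id
    where
    τσ≗id : ∀ x → ((t + m * x) - t) * m ⁻¹ ≡ x
    τσ≗id x = trans (regroup t m x (m ⁻¹)) (x*[y*y⁻¹]≡x x m≢0)
      where
      regroup : ∀ t m x m′ → ((t + m * x) - t) * m′ ≡ x * (m * m′)
      regroup = solve 4 (λ t m x m′ → ((t :+ m :* x) :- t) :* m′ := x :* (m :* m′)) refl
    στ≗id : ∀ y → t + m * ((y - t) * m ⁻¹) ≡ y
    στ≗id y = begin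
      t + m * ((y - t) * m ⁻¹)    ≡⟨ regroup t m y (m ⁻¹) ⟩
      t + (y - t) * (m * m ⁻¹)    ≡⟨ +-congˡ (x*[y*y⁻¹]≡x (y - t) m≢0) ⟩
      t + (y - t)                 ≡⟨ cancel t y ⟩
      y                           ∎
      where
      regroup : ∀ t m y m′ → t + m * ((y - t) * m′) ≡ t + (y - t) * (m * m′)
      regroup = solve 4 (λ t m y m′ → t :+ m :* ((y :- t) :* m′) := t :+ (y :- t) :* (m :* m′)) refl
      cancel : ∀ t y → t + (y - t) ≡ y
      cancel = solve 2 (λ t y → t :+ (y :- t) := y) refl

  ∑-translate : ∀ t (G : F → ℤ) → ∑[ x ] G (x + t) ≡ ∑ G
  ∑-translate t G = trans (∑-cong (λ x → cong G (affine x t))) (∑-affine 1≢0 t G)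
    where
    affine : ∀ x t → x + t ≡ t + 1# * x
    affine = solve 2 (λ x t → x :+ t := t :+ 1ₚ :* x) refl

  ∑-nonpositive≡0⇒≡0 : ∀ (f : F → ℤ) → (∀ x → f x ℤ.≤ 0ℤ) → ∑ f ≡ 0ℤ → ∀ x → f x ≡ 0ℤ
  ∑-nonpositive≡0⇒≡0 f f≤0 ∑f≡0 x =
    ℤP.≤-antisym (f≤0 x) (ℤP.≤-trans (ℤP.≤-reflexive (sym ∑f≡0)) (sum≤term elements (complete x)))
    where
    sum≤0 : ∀ xs → sumOver xs f ℤ.≤ 0ℤ
    sum≤0 []       = ℤP.≤-refl
    sum≤0 (y ∷ xs) = ℤP.+-mono-≤ (f≤0 y) (sum≤0 xs)
    sum≤term : ∀ xs {y} → y ∈ xs → sumOver xs f ℤ.≤ f y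
    sum≤term (y ∷ xs) (here refl) =
      ℤP.≤-trans (ℤP.+-monoʳ-≤ (f y) (sum≤0 xs)) (ℤP.≤-reflexive (ℤP.+-identityʳ (f y)))
    sum≤term (z ∷ xs) (there y∈) =
      ℤP.≤-trans (ℤP.+-monoˡ-≤ (sumOver xs f) (f≤0 z)) (ℤP.≤-trans (ℤP.≤-reflexive (ℤP.+-identityˡ _)) (sum≤term xs y∈))

  count2≡∑∑ : ∀ l r → + count2 l r ≡ ∑[ x ] ∑[ y ] [ l x y ≡ r x y ]
  count2≡∑∑ l r = trans (sum-map elements) (∑-cong (λ x → length-filter (l x) (r x) elements))
    where
    length-filter : ∀ (u v : F → F) xs →
                    + length (filter (λ y → u y ≟ v y) xs) ≡ sumOver xs (λ y → [ u y ≡ v y ])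
    length-filter u v []       = refl
    length-filter u v (y ∷ xs) with u y ≟ v y
    ... | yes _ = cong (λ s → 1ℤ ℤ.+ s) (length-filter u v xs)
    ... | no  _ = trans (length-filter u v xs) (sym (ℤP.+-identityˡ _))
    sum-map : ∀ {g : F → ℕ} xs → + sum (map g xs) ≡ sumOver xs (λ x → + g x)
    sum-map []           = refl
    sum-map {g} (x ∷ xs) = trans (ℤP.pos-+ (g x) _) (cong (λ s → + g x ℤ.+ s) (sum-map xs))

module QuadraticCharacter (K : FiniteField) (2≢0 : FieldProperties.2# K ≢ FiniteField.0# K) where
  open FiniteField K
  open Ops K using (φ; aq; count2)
  open FieldRingSolver K using (commutativeRing; solve; _:=_; _:+_; _:-_; _:*_; :-_; 0ₚ; 1ₚ; 2ₚ; 4ₚ)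
  open CommutativeRing commutativeRing using (+-identityˡ; *-comm; zeroˡ; zeroʳ)
  open FieldProperties K
  open FieldSums K
  open ≡-Reasoning

  4≢0 : 4# ≢ 0#
  4≢0 4≡0 = *-≢0 2≢0 2≢0 (trans 2#*2#≡4# 4≡0)

  x≡-x⇒x≡0 : ∀ {x} → x ≡ - x → x ≡ 0#
  x≡-x⇒x≡0 {x} x≡-x with x*y≡0⇒x≡0⊎y≡0 (trans (2x≡x--x x) (x≡y⇒x-y≡0 x≡-x))
    where
    2x≡x--x : ∀ x → 2# * x ≡ x - - x
    2x≡x--x = solve 1 (λ x → 2ₚ :* x := x :- (:- x)) refl
  ... | inj₁ 2≡0 = contradiction 2≡0 2≢0
  ... | inj₂ x≡0 = x≡0

  data SquareClass (z : F) : Set where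
    zero      : z ≡ 0# → SquareClass z
    square    : z ≢ 0# → ∀ s → s * s ≡ z → SquareClass z
    nonsquare : z ≢ 0# → (∀ s → s * s ≢ z) → SquareClass z

  squareClass : ∀ z → SquareClass z
  squareClass z with z ≟ 0#
  ... | yes z≡0 = zero z≡0
  ... | no  z≢0 with any? (λ s → s * s ≟ z) elements
  ...   | yes ∃√z = square z≢0 (proj₁ (satisfied ∃√z)) (proj₂ (satisfied ∃√z))
  ...   | no  ∄√z = nonsquare z≢0 (λ s s²≡z → ∄√z (lose (complete s) s²≡z))

  φ-zero : ∀ {z} → z ≡ 0# → φ z ≡ 0ℤ
  φ-zero {z} z≡0 with z ≟ 0#
  ... | yes _   = refl
  ... | no  z≢0 = contradiction z≡0 z≢0

  φ-square : ∀ {z} → z ≢ 0# → ∀ s → s * s ≡ z → φ z ≡ 1ℤ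
  φ-square {z} z≢0 s s²≡z with z ≟ 0#
  ... | yes z≡0 = contradiction z≡0 z≢0
  ... | no  _ with any? (λ s → s * s ≟ z) elements
  ...   | yes _   = refl
  ...   | no  ∄√z = contradiction (lose (complete s) s²≡z) ∄√z

  φ-nonsquare : ∀ {z} → z ≢ 0# → (∀ s → s * s ≢ z) → φ z ≡ -1ℤ
  φ-nonsquare {z} z≢0 ∄√z with z ≟ 0#
  ... | yes z≡0 = contradiction z≡0 z≢0
  ... | no  _ with any? (λ s → s * s ≟ z) elements
  ...   | yes ∃√z = contradiction (proj₂ (satisfied ∃√z)) (∄√z (proj₁ (satisfied ∃√z)))
  ...   | no  _   = refl

  φ≤1 : ∀ z → φ z ℤ.≤ 1ℤ
  φ≤1 z with squareClass z
  ... | zero z≡0             = ℤP.≤-trans (ℤP.≤-reflexive (φ-zero z≡0)) (ℤ.+≤+ z≤n)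
  ... | square z≢0 s s²≡z    = ℤP.≤-reflexive (φ-square z≢0 s s²≡z)
  ... | nonsquare z≢0 ∄√z    = ℤP.≤-trans (ℤP.≤-reflexive (φ-nonsquare z≢0 ∄√z)) ℤ.-≤+

  count-square-roots : ∀ z → ∑[ y ] [ y * y ≡ z ] ≡ 1ℤ ℤ.+ φ z
  count-square-roots z with squareClass z
  ... | zero z≡0 = begin
    ∑[ y ] [ y * y ≡ z ]   ≡⟨ ∑-cong (λ y → [≡]-cong (λ y²≡z → x*x≡0⇒x≡0 (trans y²≡z z≡0))
                                                   (λ y≡0 → trans (cong (λ t → t * t) y≡0) (trans (zeroˡ 0#) (sym z≡0)))) ⟩
    ∑[ y ] [ y ≡ 0# ]      ≡⟨ ∑-[≡] 0# ⟩
    1ℤ                     ≡⟨ cong (λ n → 1ℤ ℤ.+ n) (sym (φ-zero z≡0)) ⟩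
    1ℤ ℤ.+ φ z             ∎
  ... | square z≢0 s s²≡z = begin
    ∑[ y ] [ y * y ≡ z ]                 ≡⟨ ∑-cong ±s ⟩
    ∑[ y ] ([ y ≡ s ] ℤ.+ [ y ≡ - s ])   ≡⟨ ∑-+ (λ y → [ y ≡ s ]) (λ y → [ y ≡ - s ]) ⟩
    ∑[ y ] [ y ≡ s ] ℤ.+ ∑[ y ] [ y ≡ - s ]  ≡⟨ cong₂ ℤ._+_ (∑-[≡] s) (∑-[≡] (- s)) ⟩
    1ℤ ℤ.+ 1ℤ                            ≡⟨ cong (λ n → 1ℤ ℤ.+ n) (sym (φ-square z≢0 s s²≡z)) ⟩
    1ℤ ℤ.+ φ z                           ∎
    where
    -s*-s≡s*s : - s * - s ≡ s * s
    -s*-s≡s*s = solve 1 (λ s → (:- s) :* (:- s) := s :* s) refl s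
    ±s : ∀ y → [ y * y ≡ z ] ≡ [ y ≡ s ] ℤ.+ [ y ≡ - s ]
    ±s y with y ≟ s | y ≟ - s
    ... | yes refl | yes y≡-y = contradiction (trans (sym s²≡z) (trans (cong (λ t → t * t) (x≡-x⇒x≡0 y≡-y)) (zeroˡ 0#))) z≢0
    ... | yes refl | no  _    = [≡]-yes s²≡z
    ... | no  _    | yes refl = [≡]-yes (trans -s*-s≡s*s s²≡z)
    ... | no  y≢s  | no  y≢-s = [≡]-no (λ y²≡z → [ y≢s , y≢-s ]′ (x*x≡y*y⇒x≡y⊎x≡-y (trans y²≡z (sym s²≡z))))
  ... | nonsquare z≢0 ∄√z = begin
    ∑[ y ] [ y * y ≡ z ]   ≡⟨ ∑-cong (λ y → [≡]-no (∄√z y)) ⟩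
    ∑[ y ] 0ℤ              ≡⟨ trans (∑-const 0ℤ) (ℤP.*-zeroʳ (+ size)) ⟩
    0ℤ                     ≡⟨ cong (λ n → 1ℤ ℤ.+ n) (sym (φ-nonsquare z≢0 ∄√z)) ⟩
    1ℤ ℤ.+ φ z             ∎

  ∑φ≡0 : ∑ φ ≡ 0ℤ
  ∑φ≡0 = begin
    ∑ φ                ≡⟨ add-sub q (∑ φ) ⟩
    q ℤ.+ ∑ φ ℤ.- q    ≡⟨ cong (ℤ._- q) q+∑φ≡q ⟩
    q ℤ.- q            ≡⟨ ℤP.+-inverseʳ q ⟩
    0ℤ                 ∎
    where
    q = ∑[ z ] 1ℤ
    add-sub : ∀ a b → b ≡ a ℤ.+ b ℤ.- a
    add-sub = solve-∀
    q+∑φ≡q : q ℤ.+ ∑ φ ≡ q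
    q+∑φ≡q = begin
      ∑[ z ] 1ℤ ℤ.+ ∑ φ               ≡⟨ sym (∑-+ (λ _ → 1ℤ) φ) ⟩
      ∑[ z ] (1ℤ ℤ.+ φ z)             ≡⟨ ∑-cong (λ z → sym (count-square-roots z)) ⟩
      ∑[ z ] ∑[ y ] [ y * y ≡ z ]     ≡⟨ ∑-comm (λ z y → [ y * y ≡ z ]) ⟩
      ∑[ y ] ∑[ z ] [ y * y ≡ z ]     ≡⟨ ∑-cong (λ y → trans (∑-cong (λ z → [≡]-sym (y * y) z)) (∑-[≡] (y * y))) ⟩
      ∑[ y ] 1ℤ                       ∎

  root-≢0 : ∀ {z s} → z ≢ 0# → s * s ≡ z → s ≢ 0#
  root-≢0 {z} {s} z≢0 s²≡z s≡0 = z≢0 (trans (sym s²≡z) (trans (cong (λ t → t * t) s≡0) (zeroˡ 0#)))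

  nonsquare-*-square : ∀ {n s} → s ≢ 0# → (∀ w → w * w ≢ n) → ∀ w → w * w ≢ n * (s * s)
  nonsquare-*-square {n} {s} s≢0 ∄√n w w²≡ns² = ∄√n (w * s ⁻¹) (begin
    (w * s ⁻¹) * (w * s ⁻¹)            ≡⟨ regroup₁ w (s ⁻¹) ⟩
    (w * w) * (s ⁻¹ * s ⁻¹)            ≡⟨ cong (_* (s ⁻¹ * s ⁻¹)) w²≡ns² ⟩
    (n * (s * s)) * (s ⁻¹ * s ⁻¹)      ≡⟨ regroup₂ n s (s ⁻¹) ⟩
    (n * (s * s ⁻¹)) * (s * s ⁻¹)      ≡⟨ x*[y*y⁻¹]≡x _ s≢0 ⟩
    n * (s * s ⁻¹)                     ≡⟨ x*[y*y⁻¹]≡x n s≢0 ⟩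
    n                                  ∎)
    where
    regroup₁ : ∀ w s′ → (w * s′) * (w * s′) ≡ (w * w) * (s′ * s′)
    regroup₁ = solve 2 (λ w s′ → (w :* s′) :* (w :* s′) := (w :* w) :* (s′ :* s′)) refl
    regroup₂ : ∀ n s s′ → (n * (s * s)) * (s′ * s′) ≡ (n * (s * s′)) * (s * s′)
    regroup₂ = solve 3 (λ n s s′ → (n :* (s :* s)) :* (s′ :* s′) := (n :* (s :* s′)) :* (s :* s′)) refl

  φ-*-square : ∀ z {s} → s ≢ 0# → φ (z * (s * s)) ≡ φ z
  φ-*-square z {s} s≢0 with squareClass z
  ... | zero z≡0 = trans (φ-zero (trans (cong (_* (s * s)) z≡0) (zeroˡ _))) (sym (φ-zero z≡0))
  ... | square z≢0 t t²≡z =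
    trans (φ-square zs²≢0 (t * s) (trans (regroup t s) (cong (_* (s * s)) t²≡z))) (sym (φ-square z≢0 t t²≡z))
    where
    zs²≢0 = *-≢0 z≢0 (*-≢0 s≢0 s≢0)
    regroup : ∀ t s → (t * s) * (t * s) ≡ (t * t) * (s * s)
    regroup = solve 2 (λ t s → (t :* s) :* (t :* s) := (t :* t) :* (s :* s)) refl
  ... | nonsquare z≢0 ∄√z =
    trans (φ-nonsquare (*-≢0 z≢0 (*-≢0 s≢0 s≢0)) (nonsquare-*-square s≢0 ∄√z)) (sym (φ-nonsquare z≢0 ∄√z))

  -- φ(n u) + φ(u) is ≤ 0 for every u and sums to 0 over F, so it vanishes at u = y.
  φ-nonsquare*nonsquare : ∀ {n y} → n ≢ 0# → (∀ s → s * s ≢ n) → y ≢ 0# → (∀ s → s * s ≢ y) → φ (n * y) ≡ 1ℤ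
  φ-nonsquare*nonsquare {n} {y} n≢0 ∄√n y≢0 ∄√y = begin
    φ (n * y)                     ≡⟨ sub-add (φ (n * y)) ⟩
    φ (n * y) ℤ.+ -1ℤ ℤ.+ 1ℤ      ≡⟨ cong (λ k → φ (n * y) ℤ.+ k ℤ.+ 1ℤ) (sym (φ-nonsquare y≢0 ∄√y)) ⟩
    T y ℤ.+ 1ℤ                    ≡⟨ cong (ℤ._+ 1ℤ) (∑-nonpositive≡0⇒≡0 T T≤0 ∑T≡0 y) ⟩
    1ℤ                            ∎
    where
    sub-add : ∀ a → a ≡ a ℤ.+ -1ℤ ℤ.+ 1ℤ
    sub-add = solve-∀
    T : F → ℤ
    T u = φ (n * u) ℤ.+ φ u
    T≤0 : ∀ u → T u ℤ.≤ 0ℤ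
    T≤0 u with squareClass u
    ... | zero u≡0 = ℤP.≤-reflexive (cong₂ ℤ._+_ (φ-zero (trans (cong (n *_) u≡0) (zeroʳ n))) (φ-zero u≡0))
    ... | square u≢0 s s²≡u = ℤP.≤-reflexive (cong₂ ℤ._+_ (φ-nonsquare (*-≢0 n≢0 u≢0) ∄√nu) (φ-square u≢0 s s²≡u))
      where
      ∄√nu : ∀ w → w * w ≢ n * u
      ∄√nu w w²≡nu = nonsquare-*-square (root-≢0 u≢0 s²≡u) ∄√n w (trans w²≡nu (cong (n *_) (sym s²≡u)))
    ... | nonsquare u≢0 ∄√u = ℤP.+-mono-≤ (φ≤1 (n * u)) (ℤP.≤-reflexive (φ-nonsquare u≢0 ∄√u))
    ∑T≡0 : ∑ T ≡ 0ℤ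
    ∑T≡0 = begin
      ∑ T                          ≡⟨ ∑-+ (λ u → φ (n * u)) φ ⟩
      ∑[ u ] φ (n * u) ℤ.+ ∑ φ     ≡⟨ cong (ℤ._+ ∑ φ) (∑-cong (λ u → cong φ (sym (+-identityˡ (n * u))))) ⟩
      ∑[ u ] φ (0# + n * u) ℤ.+ ∑ φ  ≡⟨ cong (ℤ._+ ∑ φ) (∑-affine n≢0 0# φ) ⟩
      ∑ φ ℤ.+ ∑ φ                  ≡⟨ cong₂ ℤ._+_ ∑φ≡0 ∑φ≡0 ⟩
      0ℤ                           ∎

  φ-* : ∀ x y → φ (x * y) ≡ φ x ℤ.* φ y
  φ-* x y with squareClass x
  ... | zero x≡0 = trans (φ-zero (trans (cong (_* y) x≡0) (zeroˡ y))) (sym (cong (ℤ._* φ y) (φ-zero x≡0)))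
  ... | square x≢0 s s²≡x = begin
    φ (x * y)          ≡⟨ cong φ (trans (cong (_* y) (sym s²≡x)) (*-comm _ y)) ⟩
    φ (y * (s * s))    ≡⟨ φ-*-square y (root-≢0 x≢0 s²≡x) ⟩
    φ y                ≡⟨ sym (ℤP.*-identityˡ (φ y)) ⟩
    1ℤ ℤ.* φ y         ≡⟨ cong (ℤ._* φ y) (sym (φ-square x≢0 s s²≡x)) ⟩
    φ x ℤ.* φ y        ∎
  ... | nonsquare x≢0 ∄√x with squareClass y
  ...   | zero y≡0 = trans (φ-zero (trans (cong (x *_) y≡0) (zeroʳ x))) (sym (trans (cong (φ x ℤ.*_) (φ-zero y≡0)) (ℤP.*-zeroʳ (φ x))))
  ...   | square y≢0 t t²≡y = begin
    φ (x * y)          ≡⟨ cong (λ u → φ (x * u)) (sym t²≡y) ⟩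
    φ (x * (t * t))    ≡⟨ φ-*-square x (root-≢0 y≢0 t²≡y) ⟩
    φ x                ≡⟨ sym (ℤP.*-identityʳ (φ x)) ⟩
    φ x ℤ.* 1ℤ         ≡⟨ cong (φ x ℤ.*_) (sym (φ-square y≢0 t t²≡y)) ⟩
    φ x ℤ.* φ y        ∎
  ...   | nonsquare y≢0 ∄√y =
    trans (φ-nonsquare*nonsquare x≢0 ∄√x y≢0 ∄√y) (sym (cong₂ ℤ._*_ (φ-nonsquare x≢0 ∄√x) (φ-nonsquare y≢0 ∄√y)))

  count-roots-quadratic : ∀ u B → ∑[ x ] [ x * x - u * x + B ≡ 0# ] ≡ 1ℤ ℤ.+ φ (u * u - 4# * B)
  count-roots-quadratic u B = begin
    ∑[ x ] [ x * x - u * x + B ≡ 0# ]                             ≡⟨ ∑-cong (λ x → [≡]-by-scaled-difference 4≢0 (complete-square u B x)) ⟩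
    ∑[ x ] [ (- u + 2# * x) * (- u + 2# * x) ≡ u * u - 4# * B ]   ≡⟨ ∑-affine 2≢0 (- u) (λ y → [ y * y ≡ u * u - 4# * B ]) ⟩
    ∑[ y ] [ y * y ≡ u * u - 4# * B ]                             ≡⟨ count-square-roots (u * u - 4# * B) ⟩
    1ℤ ℤ.+ φ (u * u - 4# * B)                                     ∎
    where
    complete-square : ∀ u B x → 4# * ((x * x - u * x + B) - 0#) ≡ (- u + 2# * x) * (- u + 2# * x) - (u * u - 4# * B)
    complete-square = solve 3 (λ u B x → 4ₚ :* ((x :* x :- u :* x :+ B) :- 0ₚ)
                                         := (:- u :+ 2ₚ :* x) :* (:- u :+ 2ₚ :* x) :- (u :* u :- 4ₚ :* B)) refl

  count-roots-a-ex² : ∀ a {e} → e ≢ 0# → ∑[ x ] [ a - e * x * x ≡ 0# ] ≡ 1ℤ ℤ.+ φ (a * e)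
  count-roots-a-ex² a {e} e≢0 = begin
    ∑[ x ] [ a - e * x * x ≡ 0# ]                       ≡⟨ ∑-cong (λ x → [≡]-by-scaled-difference (-‿≢0 e≢0) (scale a e x)) ⟩
    ∑[ x ] [ (0# + e * x) * (0# + e * x) ≡ a * e ]      ≡⟨ ∑-affine e≢0 0# (λ y → [ y * y ≡ a * e ]) ⟩
    ∑[ y ] [ y * y ≡ a * e ]                            ≡⟨ count-square-roots (a * e) ⟩
    1ℤ ℤ.+ φ (a * e)                                    ∎
    where
    scale : ∀ a e x → - e * ((a - e * x * x) - 0#) ≡ (0# + e * x) * (0# + e * x) - a * e
    scale = solve 3 (λ a e x → :- e :* ((a :- e :* x :* x) :- 0ₚ) := (0ₚ :+ e :* x) :* (0ₚ :+ e :* x) :- a :* e) refl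

  count-u²W≡V : ∀ W V → ∑[ u ] [ u * u * W ≡ V ]
                        ≡ [ W ≡ 0# ] ℤ.* (+ size ℤ.* [ V ≡ 0# ]) ℤ.+ (1ℤ ℤ.- [ W ≡ 0# ] ℤ.+ φ (V * W))
  count-u²W≡V W V with W ≟ 0#
  ... | yes W≡0 = begin
    ∑[ u ] [ u * u * W ≡ V ]    ≡⟨ ∑-cong (λ u → [≡]-cong (λ u²W≡V → trans (sym u²W≡V) (u²W≡0 u)) (λ V≡0 → trans (u²W≡0 u) (sym V≡0))) ⟩
    ∑[ u ] [ V ≡ 0# ]           ≡⟨ ∑-const [ V ≡ 0# ] ⟩
    + size ℤ.* [ V ≡ 0# ]       ≡⟨ pad (+ size ℤ.* [ V ≡ 0# ]) ⟩
    1ℤ ℤ.* (+ size ℤ.* [ V ≡ 0# ]) ℤ.+ (1ℤ ℤ.- 1ℤ ℤ.+ 0ℤ)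
      ≡⟨ cong (λ k → 1ℤ ℤ.* (+ size ℤ.* [ V ≡ 0# ]) ℤ.+ (1ℤ ℤ.- 1ℤ ℤ.+ k)) (sym (φ-zero (trans (cong (V *_) W≡0) (zeroʳ V)))) ⟩
    1ℤ ℤ.* (+ size ℤ.* [ V ≡ 0# ]) ℤ.+ (1ℤ ℤ.- 1ℤ ℤ.+ φ (V * W))  ∎
    where
    u²W≡0 : ∀ u → u * u * W ≡ 0#
    u²W≡0 u = trans (cong (u * u *_) W≡0) (zeroʳ _)
    pad : ∀ n → n ≡ 1ℤ ℤ.* n ℤ.+ (1ℤ ℤ.- 1ℤ ℤ.+ 0ℤ)
    pad = solve-∀
  ... | no W≢0 = begin
    ∑[ u ] [ u * u * W ≡ V ]                          ≡⟨ ∑-cong (λ u → [≡]-by-scaled-difference W≢0 (scale W V u)) ⟩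
    ∑[ u ] [ (0# + W * u) * (0# + W * u) ≡ V * W ]    ≡⟨ ∑-affine W≢0 0# (λ y → [ y * y ≡ V * W ]) ⟩
    ∑[ y ] [ y * y ≡ V * W ]                          ≡⟨ count-square-roots (V * W) ⟩
    1ℤ ℤ.+ φ (V * W)                                  ≡⟨ sym (ℤP.+-identityˡ _) ⟩
    0ℤ ℤ.* (+ size ℤ.* [ V ≡ 0# ]) ℤ.+ (1ℤ ℤ.- 0ℤ ℤ.+ φ (V * W))  ∎
    where
    scale : ∀ W V u → W * (u * u * W - V) ≡ (0# + W * u) * (0# + W * u) - V * W
    scale = solve 3 (λ W V u → W :* (u :* u :* W :- V) := (0ₚ :+ W :* u) :* (0ₚ :+ W :* u) :- V :* W) refl

  cubic : F → F → F → F
  cubic A B x = x * x * x + A * x * x + B * x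

  ∑φ-cubic≡-aq : ∀ A B → ∑[ x ] φ (cubic A B x) ≡ ℤ.- aq A B
  ∑φ-cubic≡-aq A B = begin
    ∑[ x ] φ (cubic A B x)
      ≡⟨ cancel (+ size) (∑[ x ] φ (cubic A B x)) ⟩
    ℤ.- (+ size ℤ.+ 1ℤ ℤ.- (1ℤ ℤ.+ (+ size ℤ.* 1ℤ ℤ.+ ∑[ x ] φ (cubic A B x))))
      ≡⟨ cong (λ n → ℤ.- (+ size ℤ.+ 1ℤ ℤ.- (1ℤ ℤ.+ n))) (sym #affine) ⟩
    ℤ.- (+ size ℤ.+ 1ℤ ℤ.- (1ℤ ℤ.+ + count2 (λ x y → y * y) (λ x y → cubic A B x)))  ∎
    where
    cancel : ∀ q S → S ≡ ℤ.- (q ℤ.+ 1ℤ ℤ.- (1ℤ ℤ.+ (q ℤ.* 1ℤ ℤ.+ S)))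
    cancel = solve-∀
    #affine : + count2 (λ x y → y * y) (λ x y → cubic A B x) ≡ + size ℤ.* 1ℤ ℤ.+ ∑[ x ] φ (cubic A B x)
    #affine = begin
      + count2 (λ x y → y * y) (λ x y → cubic A B x)   ≡⟨ count2≡∑∑ _ _ ⟩
      ∑[ x ] ∑[ y ] [ y * y ≡ cubic A B x ]            ≡⟨ ∑-cong (λ x → count-square-roots (cubic A B x)) ⟩
      ∑[ x ] (1ℤ ℤ.+ φ (cubic A B x))                  ≡⟨ ∑-+ (λ _ → 1ℤ) (λ x → φ (cubic A B x)) ⟩
      ∑[ x ] 1ℤ ℤ.+ ∑[ x ] φ (cubic A B x)             ≡⟨ cong (ℤ._+ ∑[ x ] φ (cubic A B x)) (∑-const 1ℤ) ⟩
      + size ℤ.* 1ℤ ℤ.+ ∑[ x ] φ (cubic A B x)         ∎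

  φ-cubic≡∑ : ∀ A B x → φ (cubic A B x) ≡ (1ℤ ℤ.- [ x ≡ 0# ]) ℤ.* ∑[ u ] ([ x * x - u * x + B ≡ 0# ] ℤ.* φ (u + A))
  φ-cubic≡∑ A B x with x ≟ 0#
  ... | yes x≡0 = φ-zero (trans (cong (cubic A B) x≡0) (cubic-at-0 A B))
    where
    cubic-at-0 : ∀ A B → cubic A B 0# ≡ 0#
    cubic-at-0 = solve 2 (λ A B → 0ₚ :* 0ₚ :* 0ₚ :+ A :* 0ₚ :* 0ₚ :+ B :* 0ₚ := 0ₚ) refl
  ... | no x≢0 = begin
    φ (cubic A B x)                                         ≡⟨ cong φ (sym factor) ⟩
    φ ((r + A) * (x * x))                                   ≡⟨ φ-*-square (r + A) x≢0 ⟩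
    φ (r + A)                                               ≡⟨ sym (∑-[≡]-* (λ u → φ (u + A)) r) ⟩
    ∑[ u ] ([ u ≡ r ] ℤ.* φ (u + A))                        ≡⟨ ∑-cong (λ u → cong (ℤ._* φ (u + A)) (sym (root u))) ⟩
    ∑[ u ] ([ x * x - u * x + B ≡ 0# ] ℤ.* φ (u + A))       ≡⟨ sym (ℤP.*-identityˡ _) ⟩
    1ℤ ℤ.* ∑[ u ] ([ x * x - u * x + B ≡ 0# ] ℤ.* φ (u + A)) ∎
    where
    r = x + B * x ⁻¹
    factor : (r + A) * (x * x) ≡ cubic A B x
    factor = trans (expand x (x ⁻¹) A B) (cong (λ k → x * x * x + A * x * x + k * x) (x*[y*y⁻¹]≡x B x≢0))
      where
      expand : ∀ x x′ A B → (x + B * x′ + A) * (x * x) ≡ x * x * x + A * x * x + (B * (x * x′)) * x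
      expand = solve 4 (λ x x′ A B → (x :+ B :* x′ :+ A) :* (x :* x) := x :* x :* x :+ A :* x :* x :+ (B :* (x :* x′)) :* x) refl
    root : ∀ u → [ x * x - u * x + B ≡ 0# ] ≡ [ u ≡ r ]
    root u = sym ([≡]-by-scaled-difference (-‿≢0 x≢0)
               (trans (expand x (x ⁻¹) u B) (cong (λ k → x * x - u * x + k - 0#) (x*[y*y⁻¹]≡x B x≢0))))
      where
      expand : ∀ x x′ u B → - x * (u - (x + B * x′)) ≡ x * x - u * x + B * (x * x′) - 0#
      expand = solve 4 (λ x x′ u B → :- x :* (u :- (x :+ B :* x′)) := x :* x :- u :* x :+ B :* (x :* x′) :- 0ₚ) refl

  count-nonzero-roots : ∀ u B → ∑[ x ] ((1ℤ ℤ.- [ x ≡ 0# ]) ℤ.* [ x * x - u * x + B ≡ 0# ])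
                                ≡ 1ℤ ℤ.+ φ (u * u - 4# * B) ℤ.- [ B ≡ 0# ]
  count-nonzero-roots u B = begin
    ∑[ x ] ((1ℤ ℤ.- [ x ≡ 0# ]) ℤ.* Z x)                 ≡⟨ ∑-cong (λ x → distrib [ x ≡ 0# ] (Z x)) ⟩
    ∑[ x ] (Z x ℤ.- [ x ≡ 0# ] ℤ.* Z x)                  ≡⟨ ∑-- Z (λ x → [ x ≡ 0# ] ℤ.* Z x) ⟩
    ∑ Z ℤ.- ∑[ x ] ([ x ≡ 0# ] ℤ.* Z x)                  ≡⟨ cong₂ ℤ._-_ (count-roots-quadratic u B) (∑-[≡]-* Z 0#) ⟩
    1ℤ ℤ.+ φ (u * u - 4# * B) ℤ.- Z 0#                   ≡⟨ cong (λ k → 1ℤ ℤ.+ φ (u * u - 4# * B) ℤ.- [ k ≡ 0# ]) (at-0 u B) ⟩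
    1ℤ ℤ.+ φ (u * u - 4# * B) ℤ.- [ B ≡ 0# ]             ∎
    where
    Z : F → ℤ
    Z x = [ x * x - u * x + B ≡ 0# ]
    distrib : ∀ a b → (1ℤ ℤ.- a) ℤ.* b ≡ b ℤ.- a ℤ.* b
    distrib = solve-∀
    at-0 : ∀ u B → 0# * 0# - u * 0# + B ≡ B
    at-0 = solve 2 (λ u B → 0ₚ :* 0ₚ :- u :* 0ₚ :+ B := B) refl

  -- For x ≠ 0, φ(x³ + Ax² + Bx) = φ(u + A) with u = x + B/x, and the x ≠ 0 over a given u
  -- are the nonzero roots of x² − ux + B.
  ∑φ-cubic-over-u : ∀ A B → ∑[ x ] φ (cubic A B x) ≡ ∑[ u ] ((1ℤ ℤ.+ φ (u * u - 4# * B) ℤ.- [ B ≡ 0# ]) ℤ.* φ (u + A))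
  ∑φ-cubic-over-u A B = begin
    ∑[ x ] φ (cubic A B x)
      ≡⟨ ∑-cong (φ-cubic≡∑ A B) ⟩
    ∑[ x ] (c x ℤ.* ∑[ u ] (Z x u ℤ.* φ (u + A)))
      ≡⟨ ∑-cong (λ x → sym (∑-*ˡ (c x) (λ u → Z x u ℤ.* φ (u + A)))) ⟩
    ∑[ x ] ∑[ u ] (c x ℤ.* (Z x u ℤ.* φ (u + A)))
      ≡⟨ ∑-comm (λ x u → c x ℤ.* (Z x u ℤ.* φ (u + A))) ⟩
    ∑[ u ] ∑[ x ] (c x ℤ.* (Z x u ℤ.* φ (u + A)))
      ≡⟨ ∑-cong (λ u → trans (∑-cong (λ x → sym (ℤP.*-assoc (c x) (Z x u) _)))
                             (∑-*ʳ (φ (u + A)) (λ x → c x ℤ.* Z x u))) ⟩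
    ∑[ u ] (∑[ x ] (c x ℤ.* Z x u) ℤ.* φ (u + A))
      ≡⟨ ∑-cong (λ u → cong (ℤ._* φ (u + A)) (count-nonzero-roots u B)) ⟩
    ∑[ u ] ((1ℤ ℤ.+ φ (u * u - 4# * B) ℤ.- [ B ≡ 0# ]) ℤ.* φ (u + A))  ∎
    where
    c : F → ℤ
    c x = 1ℤ ℤ.- [ x ≡ 0# ]
    Z : F → F → ℤ
    Z x u = [ x * x - u * x + B ≡ 0# ]

  ∑φ-cubic-isogeny : ∀ A B → ∑[ x ] φ (cubic A B x) ≡ ∑[ v ] φ (cubic (- (2# * A)) (A * A - 4# * B) v)
  ∑φ-cubic-isogeny A B = begin
    ∑[ x ] φ (cubic A B x)
      ≡⟨ ∑φ-cubic-over-u A B ⟩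
    ∑[ u ] ((1ℤ ℤ.+ φ (u * u - 4# * B) ℤ.- [ B ≡ 0# ]) ℤ.* φ (u + A))
      ≡⟨ ∑-cong (λ u → distrib (φ (u * u - 4# * B)) [ B ≡ 0# ] (φ (u + A))) ⟩
    ∑[ u ] (φ (u * u - 4# * B) ℤ.* φ (u + A) ℤ.+ (1ℤ ℤ.- [ B ≡ 0# ]) ℤ.* φ (u + A))
      ≡⟨ ∑-+ (λ u → φ (u * u - 4# * B) ℤ.* φ (u + A)) (λ u → (1ℤ ℤ.- [ B ≡ 0# ]) ℤ.* φ (u + A)) ⟩
    ∑[ u ] (φ (u * u - 4# * B) ℤ.* φ (u + A)) ℤ.+ ∑[ u ] ((1ℤ ℤ.- [ B ≡ 0# ]) ℤ.* φ (u + A))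
      ≡⟨ cong₂ ℤ._+_ (∑-cong (λ u → sym (φ-* (u * u - 4# * B) (u + A)))) ∑[1-[B≡0]]φ[u+A]≡0 ⟩
    ∑[ u ] φ ((u * u - 4# * B) * (u + A)) ℤ.+ 0ℤ
      ≡⟨ ℤP.+-identityʳ _ ⟩
    ∑[ u ] φ ((u * u - 4# * B) * (u + A))
      ≡⟨ sym (∑-translate (- A) (λ u → φ ((u * u - 4# * B) * (u + A)))) ⟩
    ∑[ v ] φ (((v - A) * (v - A) - 4# * B) * ((v - A) + A))
      ≡⟨ ∑-cong (λ v → cong φ (shift A B v)) ⟩
    ∑[ v ] φ (cubic (- (2# * A)) (A * A - 4# * B) v)  ∎
    where
    distrib : ∀ p b f → (1ℤ ℤ.+ p ℤ.- b) ℤ.* f ≡ p ℤ.* f ℤ.+ (1ℤ ℤ.- b) ℤ.* f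
    distrib = solve-∀
    ∑[1-[B≡0]]φ[u+A]≡0 : ∑[ u ] ((1ℤ ℤ.- [ B ≡ 0# ]) ℤ.* φ (u + A)) ≡ 0ℤ
    ∑[1-[B≡0]]φ[u+A]≡0 = begin
      ∑[ u ] ((1ℤ ℤ.- [ B ≡ 0# ]) ℤ.* φ (u + A))   ≡⟨ ∑-*ˡ (1ℤ ℤ.- [ B ≡ 0# ]) (λ u → φ (u + A)) ⟩
      (1ℤ ℤ.- [ B ≡ 0# ]) ℤ.* ∑[ u ] φ (u + A)     ≡⟨ cong ((1ℤ ℤ.- [ B ≡ 0# ]) ℤ.*_) (trans (∑-translate A φ) ∑φ≡0) ⟩
      (1ℤ ℤ.- [ B ≡ 0# ]) ℤ.* 0ℤ                   ≡⟨ ℤP.*-zeroʳ (1ℤ ℤ.- [ B ≡ 0# ]) ⟩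
      0ℤ                                           ∎
    shift : ∀ A B v → ((v - A) * (v - A) - 4# * B) * ((v - A) + A) ≡ cubic (- (2# * A)) (A * A - 4# * B) v
    shift = solve 3 (λ A B v → ((v :- A) :* (v :- A) :- 4ₚ :* B) :* ((v :- A) :+ A)
                              := v :* v :* v :+ (:- (2ₚ :* A)) :* v :* v :+ (A :* A :- 4ₚ :* B) :* v) refl

  ∑φ-even : ∀ (P : F → F) → ∑[ x ] φ (P (x * x)) ≡ ∑[ t ] φ (P t) ℤ.+ ∑[ t ] φ (t * P t)
  ∑φ-even P = begin
    ∑[ x ] φ (P (x * x))                          ≡⟨ ∑-fibres (λ x → x * x) (λ t → φ (P t)) ⟩
    ∑[ t ] (φ (P t) ℤ.* ∑[ x ] [ x * x ≡ t ])     ≡⟨ ∑-cong (λ t → cong (φ (P t) ℤ.*_) (count-square-roots t)) ⟩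
    ∑[ t ] (φ (P t) ℤ.* (1ℤ ℤ.+ φ t))             ≡⟨ ∑-cong (λ t → trans (distrib (φ (P t)) (φ t))
                                                                        (cong (λ k → φ (P t) ℤ.+ k) (sym (φ-* t (P t))))) ⟩
    ∑[ t ] (φ (P t) ℤ.+ φ (t * P t))              ≡⟨ ∑-+ (λ t → φ (P t)) (λ t → φ (t * P t)) ⟩
    ∑[ t ] φ (P t) ℤ.+ ∑[ t ] φ (t * P t)         ∎
    where
    distrib : ∀ a b → a ℤ.* (1ℤ ℤ.+ b) ≡ a ℤ.+ b ℤ.* a
    distrib = solve-∀

  -- _⁻¹ is unconstrained at 0; sending 0 to 0 makes inversion an involution of F.
  inv₀ : F → F
  inv₀ x with x ≟ 0#
  ... | yes _ = 0#
  ... | no  _ = x ⁻¹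

  inv₀-involutive : ∀ x → inv₀ (inv₀ x) ≡ x
  inv₀-involutive x with x ≟ 0#
  ... | yes x≡0 = trans inv₀-0 (sym x≡0)
    where
    inv₀-0 : inv₀ 0# ≡ 0#
    inv₀-0 with 0# ≟ 0#
    ... | yes _   = refl
    ... | no  0≢0 = contradiction refl 0≢0
  ... | no x≢0 with x ⁻¹ ≟ 0#
  ...   | yes x⁻¹≡0 = contradiction x⁻¹≡0 (⁻¹-≢0 x≢0)
  ...   | no  _     = ⁻¹-involutive x≢0

  ∑φ-reciprocal : ∀ α β γ ε → ∑[ t ] φ (t * ((α - β * (t * t)) * (γ - ε * t)))
                              ≡ ∑[ s ] φ ((β - α * (s * s)) * (ε - γ * s)) ℤ.- φ (β * ε)
  ∑φ-reciprocal α β γ ε = begin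
    ∑[ t ] φ (t * P t)
      ≡⟨ sym (∑-reindex inv₀ inv₀ inv₀-involutive inv₀-involutive (λ t → φ (t * P t))) ⟩
    ∑[ s ] φ (inv₀ s * P (inv₀ s))                           ≡⟨ ∑-cong pointwise ⟩
    ∑[ s ] (φ (P′ s) ℤ.- [ s ≡ 0# ] ℤ.* φ (β * ε))           ≡⟨ ∑-- (λ s → φ (P′ s)) (λ s → [ s ≡ 0# ] ℤ.* φ (β * ε)) ⟩
    ∑[ s ] φ (P′ s) ℤ.- ∑[ s ] ([ s ≡ 0# ] ℤ.* φ (β * ε))    ≡⟨ cong (λ k → ∑[ s ] φ (P′ s) ℤ.- k) (∑-[≡]-* (λ _ → φ (β * ε)) 0#) ⟩
    ∑[ s ] φ (P′ s) ℤ.- φ (β * ε)                            ∎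
    where
    P P′ : F → F
    P t = (α - β * (t * t)) * (γ - ε * t)
    P′ s = (β - α * (s * s)) * (ε - γ * s)
    P′-at-0 : P′ 0# ≡ β * ε
    P′-at-0 = solve 4 (λ α β γ ε → (β :- α :* (0ₚ :* 0ₚ)) :* (ε :- γ :* 0ₚ) := β :* ε) refl α β γ ε
    reciprocal : ∀ {s} → s ≢ 0# → P′ s * ((s ⁻¹ * s ⁻¹) * (s ⁻¹ * s ⁻¹)) ≡ s ⁻¹ * P (s ⁻¹)
    reciprocal {s} s≢0 = begin
      P′ s * ((s′ * s′) * (s′ * s′))                                       ≡⟨ expand α β γ ε s s′ ⟩
      s′ * ((α * ((s * s′) * (s * s′)) - β * (s′ * s′)) * (γ * (s * s′) - ε * s′))
        ≡⟨ cong (λ u → s′ * ((α * (u * u) - β * (s′ * s′)) * (γ * u - ε * s′))) (⁻¹-inverse s s≢0) ⟩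
      s′ * ((α * (1# * 1#) - β * (s′ * s′)) * (γ * 1# - ε * s′))          ≡⟨ simplify α β γ ε s′ ⟩
      s′ * P s′                                                            ∎
      where
      s′ = s ⁻¹
      expand : ∀ α β γ ε s s′ → ((β - α * (s * s)) * (ε - γ * s)) * ((s′ * s′) * (s′ * s′))
                                ≡ s′ * ((α * ((s * s′) * (s * s′)) - β * (s′ * s′)) * (γ * (s * s′) - ε * s′))
      expand = solve 6 (λ α β γ ε s s′ → ((β :- α :* (s :* s)) :* (ε :- γ :* s)) :* ((s′ :* s′) :* (s′ :* s′))
                         := s′ :* ((α :* ((s :* s′) :* (s :* s′)) :- β :* (s′ :* s′)) :* (γ :* (s :* s′) :- ε :* s′))) refl
      simplify : ∀ α β γ ε s′ → s′ * ((α * (1# * 1#) - β * (s′ * s′)) * (γ * 1# - ε * s′))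
                                ≡ s′ * ((α - β * (s′ * s′)) * (γ - ε * s′))
      simplify = solve 5 (λ α β γ ε s′ → s′ :* ((α :* (1ₚ :* 1ₚ) :- β :* (s′ :* s′)) :* (γ :* 1ₚ :- ε :* s′))
                           := s′ :* ((α :- β :* (s′ :* s′)) :* (γ :- ε :* s′))) refl
    pointwise : ∀ s → φ (inv₀ s * P (inv₀ s)) ≡ φ (P′ s) ℤ.- [ s ≡ 0# ] ℤ.* φ (β * ε)
    pointwise s with s ≟ 0#
    ... | yes s≡0 = begin
      φ (0# * P 0#)                    ≡⟨ φ-zero (zeroˡ (P 0#)) ⟩
      0ℤ                               ≡⟨ sym (ℤP.+-inverseʳ (φ (β * ε))) ⟩
      φ (β * ε) ℤ.- φ (β * ε)          ≡⟨ cong₂ ℤ._-_ (cong φ (sym (trans (cong P′ s≡0) P′-at-0))) (sym (ℤP.*-identityˡ _)) ⟩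
      φ (P′ s) ℤ.- 1ℤ ℤ.* φ (β * ε)    ∎
    ... | no s≢0 = begin
      φ (s ⁻¹ * P (s ⁻¹))                              ≡⟨ cong φ (sym (reciprocal s≢0)) ⟩
      φ (P′ s * ((s ⁻¹ * s ⁻¹) * (s ⁻¹ * s ⁻¹)))       ≡⟨ φ-*-square (P′ s) (*-≢0 (⁻¹-≢0 s≢0) (⁻¹-≢0 s≢0)) ⟩
      φ (P′ s)                                         ≡⟨ sym (ℤP.+-identityʳ _) ⟩
      φ (P′ s) ℤ.- 0ℤ ℤ.* φ (β * ε)                    ∎

  -- t = m(x − h) with m = −γ/(εh) sends x = 0 to the root γ/ε of the linear factor.
  ∑φ-quadratic×linear : ∀ {α β γ ε h g} → γ ≢ 0# → ε ≢ 0# → h ≢ 0# →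
                        α * (ε * ε) * (h * h) ≡ 4# * g * β * (γ * γ) →
                        ∑[ t ] φ ((α - β * (t * t)) * (γ - ε * t)) ≡ φ (- (β * γ * h)) ℤ.* ∑[ x ] φ (cubic h g x)
  ∑φ-quadratic×linear {α} {β} {γ} {ε} {h} {g} γ≢0 ε≢0 h≢0 eq = begin
    ∑[ t ] φ (P t)                           ≡⟨ sym (∑-affine m≢0 (- (h * m)) (λ t → φ (P t))) ⟩
    ∑[ x ] φ (P (- (h * m) + m * x))         ≡⟨ ∑-cong (λ x → trans (cong φ (substitute x)) (φ-* κ (C x))) ⟩
    ∑[ x ] (φ κ ℤ.* φ (C x))                 ≡⟨ ∑-*ˡ (φ κ) (λ x → φ (C x)) ⟩
    φ κ ℤ.* ∑[ x ] φ (C x)                   ≡⟨ cong₂ ℤ._*_ φκ (sym (∑φ-cubic-isogeny h g)) ⟩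
    φ (- (β * γ * h)) ℤ.* ∑[ x ] φ (cubic h g x)  ∎
    where
    P C : F → F
    P t = (α - β * (t * t)) * (γ - ε * t)
    C = cubic (- (2# * h)) (h * h - 4# * g)
    εh≢0 : ε * h ≢ 0#
    εh≢0 = *-≢0 ε≢0 h≢0
    m κ : F
    m = - (γ * (ε * h) ⁻¹)
    κ = β * ε * (m * m * m)
    m≢0 : m ≢ 0#
    m≢0 = -‿≢0 (*-≢0 γ≢0 (⁻¹-≢0 εh≢0))
    γ≡ : γ ≡ - (ε * h * m)
    γ≡ = trans (sym (x*[y*y⁻¹]≡x γ εh≢0)) (regroup γ (ε * h) ((ε * h) ⁻¹))
      where
      regroup : ∀ γ w w′ → γ * (w * w′) ≡ - (w * - (γ * w′))
      regroup = solve 3 (λ γ w w′ → γ :* (w :* w′) := :- (w :* :- (γ :* w′))) refl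
    α≡ : α ≡ 4# * g * β * (m * m)
    α≡ = *-cancelˡ-≡ (*-≢0 εh≢0 εh≢0) (begin
      (ε * h) * (ε * h) * α                          ≡⟨ regroup₁ ε h α ⟩
      α * (ε * ε) * (h * h)                          ≡⟨ eq ⟩
      4# * g * β * (γ * γ)                           ≡⟨ cong (λ k → 4# * g * β * (k * k)) γ≡ ⟩
      4# * g * β * (- (ε * h * m) * - (ε * h * m))   ≡⟨ regroup₂ g β ε h m ⟩
      (ε * h) * (ε * h) * (4# * g * β * (m * m))     ∎)
      where
      regroup₁ : ∀ ε h α → (ε * h) * (ε * h) * α ≡ α * (ε * ε) * (h * h)
      regroup₁ = solve 3 (λ ε h α → (ε :* h) :* (ε :* h) :* α := α :* (ε :* ε) :* (h :* h)) refl
      regroup₂ : ∀ g β ε h m → 4# * g * β * (- (ε * h * m) * - (ε * h * m)) ≡ (ε * h) * (ε * h) * (4# * g * β * (m * m))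
      regroup₂ = solve 5 (λ g β ε h m → 4ₚ :* g :* β :* (:- (ε :* h :* m) :* :- (ε :* h :* m))
                                        := (ε :* h) :* (ε :* h) :* (4ₚ :* g :* β :* (m :* m))) refl
    substitute : ∀ x → P (- (h * m) + m * x) ≡ κ * C x
    substitute x = trans (cong₂ (λ α′ γ′ → (α′ - β * (t * t)) * (γ′ - ε * t)) α≡ γ≡) (expand g β ε h m x)
      where
      t = - (h * m) + m * x
      expand : ∀ g β ε h m x →
               (4# * g * β * (m * m) - β * ((- (h * m) + m * x) * (- (h * m) + m * x))) * (- (ε * h * m) - ε * (- (h * m) + m * x))
               ≡ β * ε * (m * m * m) * cubic (- (2# * h)) (h * h - 4# * g) x
      expand = solve 6 (λ g β ε h m x →
               (4ₚ :* g :* β :* (m :* m) :- β :* ((:- (h :* m) :+ m :* x) :* (:- (h :* m) :+ m :* x))) :* (:- (ε :* h :* m) :- ε :* (:- (h :* m) :+ m :* x))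
               := β :* ε :* (m :* m :* m) :* (x :* x :* x :+ :- (2ₚ :* h) :* x :* x :+ (h :* h :- 4ₚ :* g) :* x)) refl
    φκ : φ κ ≡ φ (- (β * γ * h))
    φκ = begin
      φ (β * ε * (m * m * m))          ≡⟨ cong φ (regroup₁ β ε m) ⟩
      φ (β * ε * m * (m * m))          ≡⟨ φ-*-square (β * ε * m) m≢0 ⟩
      φ (β * ε * m)                    ≡⟨ sym (φ-*-square (β * ε * m) h≢0) ⟩
      φ (β * ε * m * (h * h))          ≡⟨ cong φ (sym (trans (cong (λ γ′ → - (β * γ′ * h)) γ≡) (regroup₂ β ε h m))) ⟩
      φ (- (β * γ * h))                ∎
      where
      regroup₁ : ∀ β ε m → β * ε * (m * m * m) ≡ β * ε * m * (m * m)
      regroup₁ = solve 3 (λ β ε m → β :* ε :* (m :* m :* m) := β :* ε :* m :* (m :* m)) refl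
      regroup₂ : ∀ β ε h m → - (β * - (ε * h * m) * h) ≡ β * ε * m * (h * h)
      regroup₂ = solve 4 (λ β ε h m → :- (β :* :- (ε :* h :* m) :* h) := β :* ε :* m :* (h :* h)) refl

module PointCount (K : FiniteField) where
  open FiniteField K
  open Ops K using (φ; δ; aq; #C)
  open FieldRingSolver K using (commutativeRing; solve; _:=_; _:+_; _:-_; _:*_; :-_; 0ₚ; 1ₚ; 2ₚ; 4ₚ)
  open CommutativeRing commutativeRing using (zeroʳ)
  open FieldProperties K
  open FieldSums K
  open ≡-Reasoning

  complete-square-in-y : ∀ {a b c d e f} k → b ≡ a * k * k → c ≡ 2# * a * k → f ≡ 2# * e * k → ∀ x →
    ∑[ y ] [ a * y * y + b * x * x + c * x * y ≡ d + e * x * x * y * y + f * x * x * x * y ]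
    ≡ ∑[ u ] [ u * u * (a - e * x * x) ≡ d - e * k * k * (x * x * x * x) ]
  complete-square-in-y {a} {d = d} {e} k refl refl refl x = begin
    ∑[ y ] [ L y ≡ R y ]                          ≡⟨ sym (∑-translate (- (k * x)) (λ y → [ L y ≡ R y ])) ⟩
    ∑[ u ] [ L (u - k * x) ≡ R (u - k * x) ]      ≡⟨ ∑-cong (λ u → [≡]-by-difference (shear a d e k x u)) ⟩
    ∑[ u ] [ u * u * (a - e * x * x) ≡ d - e * k * k * (x * x * x * x) ]  ∎
    where
    L R : F → F
    L y = a * y * y + a * k * k * x * x + 2# * a * k * x * y
    R y = d + e * x * x * y * y + 2# * e * k * x * x * x * y
    shear : ∀ a d e k x u →
      (a * (u - k * x) * (u - k * x) + a * k * k * x * x + 2# * a * k * x * (u - k * x))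
        - (d + e * x * x * (u - k * x) * (u - k * x) + 2# * e * k * x * x * x * (u - k * x))
      ≡ u * u * (a - e * x * x) - (d - e * k * k * (x * x * x * x))
    shear = solve 6 (λ a d e k x u →
      (a :* (u :- k :* x) :* (u :- k :* x) :+ a :* k :* k :* x :* x :+ 2ₚ :* a :* k :* x :* (u :- k :* x))
        :- (d :+ e :* x :* x :* (u :- k :* x) :* (u :- k :* x) :+ 2ₚ :* e :* k :* x :* x :* x :* (u :- k :* x))
      := u :* u :* (a :- e :* x :* x) :- (d :- e :* k :* k :* (x :* x :* x :* x))) refl

  module Curve {a b c d e f h g : F}
    (a≢0 : a ≢ 0#) (c≢0 : c ≢ 0#) (d≢0 : d ≢ 0#) (e≢0 : e ≢ 0#) (h≢0 : h ≢ 0#) (g≢0 : g ≢ 0#)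
    (af≡ce : a * f ≡ c * e) (c²-4ab≡0 : c * c - 4# * a * b ≡ 0#) (c²g≡h²de : c * c * g ≡ h * h * d * e)
    where

    c²≡4ab : c * c ≡ 4# * a * b
    c²≡4ab = x-y≡0⇒x≡y _ _ c²-4ab≡0

    2≢0 : 2# ≢ 0#
    2≢0 2≡0 = c≢0 (x*x≡0⇒x≡0 (begin
      c * c              ≡⟨ c²≡4ab ⟩
      4# * a * b         ≡⟨ cong (λ t → t * a * b) (sym 2#*2#≡4#) ⟩
      2# * 2# * a * b    ≡⟨ cong (λ t → t * 2# * a * b) 2≡0 ⟩
      0# * 2# * a * b    ≡⟨ solve 3 (λ t a b → 0ₚ :* t :* a :* b := 0ₚ) refl 2# a b ⟩
      0#                 ∎))

    open QuadraticCharacter K 2≢0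

    k : F
    k = c * (2# * a) ⁻¹

    2a≢0 : 2# * a ≢ 0#
    2a≢0 = *-≢0 2≢0 a≢0

    k≢0 : k ≢ 0#
    k≢0 = *-≢0 c≢0 (⁻¹-≢0 2a≢0)

    c≡2ak : c ≡ 2# * a * k
    c≡2ak = sym (trans (regroup (2# * a) c ((2# * a) ⁻¹)) (x*[y*y⁻¹]≡x c 2a≢0))
      where
      regroup : ∀ w c w′ → w * (c * w′) ≡ c * (w * w′)
      regroup = solve 3 (λ w c w′ → w :* (c :* w′) := c :* (w :* w′)) refl

    b≡akk : b ≡ a * k * k
    b≡akk = *-cancelˡ-≡ (*-≢0 4≢0 a≢0) (begin
      4# * a * b                       ≡⟨ sym c²≡4ab ⟩
      c * c                            ≡⟨ cong (λ t → t * t) c≡2ak ⟩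
      (2# * a * k) * (2# * a * k)      ≡⟨ solve 2 (λ a k → (2ₚ :* a :* k) :* (2ₚ :* a :* k) := 4ₚ :* a :* (a :* k :* k)) refl a k ⟩
      4# * a * (a * k * k)             ∎)

    f≡2ek : f ≡ 2# * e * k
    f≡2ek = *-cancelˡ-≡ a≢0 (begin
      a * f               ≡⟨ af≡ce ⟩
      c * e               ≡⟨ cong (_* e) c≡2ak ⟩
      2# * a * k * e      ≡⟨ solve 3 (λ a e k → 2ₚ :* a :* k :* e := a :* (2ₚ :* e :* k)) refl a e k ⟩
      a * (2# * e * k)    ∎)

    4a²k²g≡h²de : 4# * (a * a) * (k * k) * g ≡ h * h * d * e
    4a²k²g≡h²de = begin
      4# * (a * a) * (k * k) * g
        ≡⟨ solve 3 (λ a k g → 4ₚ :* (a :* a) :* (k :* k) :* g := (2ₚ :* a :* k) :* (2ₚ :* a :* k) :* g) refl a k g ⟩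
      (2# * a * k) * (2# * a * k) * g  ≡⟨ cong (λ t → t * t * g) (sym c≡2ak) ⟩
      c * c * g                        ≡⟨ c²g≡h²de ⟩
      h * h * d * e                    ∎

    w v : F → F
    w x = a - e * x * x
    v x = d - e * k * k * (x * x * x * x)

    D : F
    D = 1# - a * b * (d * e) ⁻¹

    de≢0 : d * e ≢ 0#
    de≢0 = *-≢0 d≢0 e≢0

    e*v≡de*D : ∀ {x} → w x ≡ 0# → e * v x ≡ (d * e) * D
    e*v≡de*D {x} wx≡0 = begin
      e * (d - e * k * k * (x * x * x * x))      ≡⟨ regroup₁ d e k x ⟩
      d * e - k * k * ((e * x * x) * (e * x * x)) ≡⟨ cong (λ t → d * e - k * k * (t * t)) (sym (x-y≡0⇒x≡y _ _ wx≡0)) ⟩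
      d * e - k * k * (a * a)                    ≡⟨ regroup₂ d e k a ⟩
      d * e - a * (a * k * k)                    ≡⟨ cong (λ t → d * e - a * t) (sym b≡akk) ⟩
      d * e - a * b                              ≡⟨ cong (λ t → d * e - t) (sym (x*[y*y⁻¹]≡x (a * b) de≢0)) ⟩
      d * e - a * b * ((d * e) * (d * e) ⁻¹)     ≡⟨ regroup₃ a b (d * e) ((d * e) ⁻¹) ⟩
      (d * e) * D                                ∎
      where
      regroup₁ : ∀ d e k x → e * (d - e * k * k * (x * x * x * x)) ≡ d * e - k * k * ((e * x * x) * (e * x * x))
      regroup₁ = solve 4 (λ d e k x → e :* (d :- e :* k :* k :* (x :* x :* x :* x)) := d :* e :- k :* k :* ((e :* x :* x) :* (e :* x :* x))) refl
      regroup₂ : ∀ d e k a → d * e - k * k * (a * a) ≡ d * e - a * (a * k * k)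
      regroup₂ = solve 4 (λ d e k a → d :* e :- k :* k :* (a :* a) := d :* e :- a :* (a :* k :* k)) refl
      regroup₃ : ∀ a b m m′ → m - a * b * (m * m′) ≡ m * (1# - a * b * m′)
      regroup₃ = solve 4 (λ a b m m′ → m :- a :* b :* (m :* m′) := m :* (1ₚ :- a :* b :* m′)) refl

    [v≡0]≡δD : ∀ {x} → w x ≡ 0# → [ v x ≡ 0# ] ≡ δ D
    [v≡0]≡δD {x} wx≡0 = trans ([≡]-cong v≡0⇒D≡0 D≡0⇒v≡0) (sym (δ≡[≡0] D))
      where
      v≡0⇒D≡0 : v x ≡ 0# → D ≡ 0#
      v≡0⇒D≡0 vx≡0 = *-cancelˡ-≡ de≢0 (trans (sym (e*v≡de*D wx≡0)) (trans (cong (e *_) vx≡0) (trans (zeroʳ e) (sym (zeroʳ _)))))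
      D≡0⇒v≡0 : D ≡ 0# → v x ≡ 0#
      D≡0⇒v≡0 D≡0 = *-cancelˡ-≡ e≢0 (trans (e*v≡de*D wx≡0) (trans (cong ((d * e) *_) D≡0) (trans (zeroʳ _) (sym (zeroʳ e)))))

    #C≡ : + #C a b c d e f ≡ (1ℤ ℤ.+ φ (a * e)) ℤ.* (+ size ℤ.* δ D) ℤ.+ (+ size ℤ.- (1ℤ ℤ.+ φ (a * e)) ℤ.+ ∑[ x ] φ (v x * w x))
    #C≡ = begin
      + #C a b c d e f
        ≡⟨ count2≡∑∑ _ _ ⟩
      ∑[ x ] ∑[ y ] [ a * y * y + b * x * x + c * x * y ≡ d + e * x * x * y * y + f * x * x * x * y ]
        ≡⟨ ∑-cong (complete-square-in-y k b≡akk c≡2ak f≡2ek) ⟩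
      ∑[ x ] ∑[ u ] [ u * u * w x ≡ v x ]
        ≡⟨ ∑-cong (λ x → count-u²W≡V (w x) (v x)) ⟩
      ∑[ x ] (W x ℤ.* (q ℤ.* [ v x ≡ 0# ]) ℤ.+ (1ℤ ℤ.- W x ℤ.+ Φ x))
        ≡⟨ ∑-cong (λ x → cong (ℤ._+ (1ℤ ℤ.- W x ℤ.+ Φ x)) ([≡]*-cong (λ wx≡0 → cong (q ℤ.*_) ([v≡0]≡δD wx≡0)))) ⟩
      ∑[ x ] (W x ℤ.* (q ℤ.* δ D) ℤ.+ (1ℤ ℤ.- W x ℤ.+ Φ x))
        ≡⟨ ∑-+ (λ x → W x ℤ.* (q ℤ.* δ D)) (λ x → 1ℤ ℤ.- W x ℤ.+ Φ x) ⟩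
      ∑[ x ] (W x ℤ.* (q ℤ.* δ D)) ℤ.+ ∑[ x ] (1ℤ ℤ.- W x ℤ.+ Φ x)
        ≡⟨ cong₂ ℤ._+_ (∑-*ʳ (q ℤ.* δ D) W) (trans (∑-+ (λ x → 1ℤ ℤ.- W x) Φ) (cong (ℤ._+ ∑ Φ) (∑-- (λ _ → 1ℤ) W))) ⟩
      ∑ W ℤ.* (q ℤ.* δ D) ℤ.+ (∑[ x ] 1ℤ ℤ.- ∑ W ℤ.+ ∑ Φ)
        ≡⟨ cong₂ (λ n m → n ℤ.* (q ℤ.* δ D) ℤ.+ (m ℤ.- n ℤ.+ ∑ Φ)) (count-roots-a-ex² a e≢0) (trans (∑-const 1ℤ) (ℤP.*-identityʳ q)) ⟩
      (1ℤ ℤ.+ φ (a * e)) ℤ.* (q ℤ.* δ D) ℤ.+ (q ℤ.- (1ℤ ℤ.+ φ (a * e)) ℤ.+ ∑ Φ)  ∎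
      where
      q = + size
      W Φ : F → ℤ
      W x = [ w x ≡ 0# ]
      Φ x = φ (v x * w x)

    Q : F → F
    Q t = (d - e * k * k * (t * t)) * (a - e * t)

    ∑φ-Q : ∑[ t ] φ (Q t) ≡ φ (- (a * e * h)) ℤ.* ℤ.- aq h g
    ∑φ-Q = trans (∑φ-quadratic×linear a≢0 e≢0 h≢0 condition) (cong₂ ℤ._*_ φ-factor (∑φ-cubic≡-aq h g))
      where
      condition : d * (e * e) * (h * h) ≡ 4# * g * (e * k * k) * (a * a)
      condition = begin
        d * (e * e) * (h * h)             ≡⟨ solve 3 (λ d e h → d :* (e :* e) :* (h :* h) := e :* (h :* h :* d :* e)) refl d e h ⟩
        e * (h * h * d * e)               ≡⟨ cong (e *_) (sym 4a²k²g≡h²de) ⟩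
        e * (4# * (a * a) * (k * k) * g)  ≡⟨ solve 4 (λ e a k g → e :* (4ₚ :* (a :* a) :* (k :* k) :* g)
                                                                := 4ₚ :* g :* (e :* k :* k) :* (a :* a)) refl e a k g ⟩
        4# * g * (e * k * k) * (a * a)    ∎
      φ-factor : φ (- (e * k * k * a * h)) ≡ φ (- (a * e * h))
      φ-factor = trans (cong φ (solve 4 (λ e k a h → :- (e :* k :* k :* a :* h) := :- (a :* e :* h) :* (k :* k)) refl e k a h))
                       (φ-*-square (- (a * e * h)) k≢0)

    h′ g′ : F
    h′ = h ⁻¹
    g′ = g ⁻¹

    φ[-de4h′]≡φ[-hg] : φ (- (d * e * (4# * h′))) ≡ φ (- (h * g))
    φ[-de4h′]≡φ[-hg] = trans (cong φ (sym square-factor)) (φ-*-square (- (h * g)) r≢0)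
      where
      r = 4# * a * k * h′ * h′
      r≢0 : r ≢ 0#
      r≢0 = *-≢0 (*-≢0 (*-≢0 (*-≢0 4≢0 a≢0) k≢0) (⁻¹-≢0 h≢0)) (⁻¹-≢0 h≢0)
      square-factor : - (h * g) * (r * r) ≡ - (d * e * (4# * h′))
      square-factor = begin
        - (h * g) * (r * r)
          ≡⟨ solve 5 (λ h g a k h′ → :- (h :* g) :* ((4ₚ :* a :* k :* h′ :* h′) :* (4ₚ :* a :* k :* h′ :* h′))
                                    := :- (4ₚ :* (h′ :* h′ :* h′) :* (4ₚ :* (a :* a) :* (k :* k) :* g)) :* (h :* h′)) refl h g a k h′ ⟩
        - (4# * (h′ * h′ * h′) * (4# * (a * a) * (k * k) * g)) * (h * h′)  ≡⟨ x*[y*y⁻¹]≡x _ h≢0 ⟩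
        - (4# * (h′ * h′ * h′) * (4# * (a * a) * (k * k) * g))             ≡⟨ cong (λ t → - (4# * (h′ * h′ * h′) * t)) 4a²k²g≡h²de ⟩
        - (4# * (h′ * h′ * h′) * (h * h * d * e))
          ≡⟨ solve 4 (λ h′ h d e → :- (4ₚ :* (h′ :* h′ :* h′) :* (h :* h :* d :* e))
                                  := :- (d :* e :* (4ₚ :* h′)) :* (h :* h′) :* (h :* h′)) refl h′ h d e ⟩
        - (d * e * (4# * h′)) * (h * h′) * (h * h′)                        ≡⟨ x*[y*y⁻¹]≡x _ h≢0 ⟩
        - (d * e * (4# * h′)) * (h * h′)                                   ≡⟨ x*[y*y⁻¹]≡x _ h≢0 ⟩
        - (d * e * (4# * h′))                                              ∎

    ∑φ-tQ : ∑[ t ] φ (t * Q t) ≡ φ (- (h * g)) ℤ.* ℤ.- aq (4# * h′) g′ ℤ.- 1ℤ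
    ∑φ-tQ = begin
      ∑[ t ] φ (t * Q t)                                                         ≡⟨ ∑φ-reciprocal d (e * k * k) a e ⟩
      ∑[ s ] φ ((e * k * k - d * (s * s)) * (e - a * s)) ℤ.- φ (e * k * k * e)
        ≡⟨ cong₂ ℤ._-_ (∑φ-quadratic×linear e≢0 a≢0 (*-≢0 4≢0 (⁻¹-≢0 h≢0)) condition) φ-ekke ⟩
      φ (- (d * e * (4# * h′))) ℤ.* ∑[ x ] φ (cubic (4# * h′) g′ x) ℤ.- 1ℤ
        ≡⟨ cong₂ (λ s t → s ℤ.* t ℤ.- 1ℤ) φ[-de4h′]≡φ[-hg] (∑φ-cubic≡-aq (4# * h′) g′) ⟩
      φ (- (h * g)) ℤ.* ℤ.- aq (4# * h′) g′ ℤ.- 1ℤ                                ∎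
      where
      condition : e * k * k * (a * a) * ((4# * h′) * (4# * h′)) ≡ 4# * g′ * d * (e * e)
      condition = begin
        e * k * k * (a * a) * ((4# * h′) * (4# * h′))             ≡⟨ sym (x*[y*y⁻¹]≡x _ g≢0) ⟩
        e * k * k * (a * a) * ((4# * h′) * (4# * h′)) * (g * g′)
          ≡⟨ solve 6 (λ e k a h′ g g′ → e :* k :* k :* (a :* a) :* ((4ₚ :* h′) :* (4ₚ :* h′)) :* (g :* g′)
                                      := 4ₚ :* e :* (h′ :* h′) :* g′ :* (4ₚ :* (a :* a) :* (k :* k) :* g)) refl e k a h′ g g′ ⟩
        4# * e * (h′ * h′) * g′ * (4# * (a * a) * (k * k) * g)    ≡⟨ cong (λ t → 4# * e * (h′ * h′) * g′ * t) 4a²k²g≡h²de ⟩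
        4# * e * (h′ * h′) * g′ * (h * h * d * e)
          ≡⟨ solve 5 (λ e h h′ g′ d → 4ₚ :* e :* (h′ :* h′) :* g′ :* (h :* h :* d :* e)
                                    := 4ₚ :* g′ :* d :* (e :* e) :* (h :* h′) :* (h :* h′)) refl e h h′ g′ d ⟩
        4# * g′ * d * (e * e) * (h * h′) * (h * h′)               ≡⟨ x*[y*y⁻¹]≡x _ h≢0 ⟩
        4# * g′ * d * (e * e) * (h * h′)                          ≡⟨ x*[y*y⁻¹]≡x _ h≢0 ⟩
        4# * g′ * d * (e * e)                                     ∎
      φ-ekke : φ (e * k * k * e) ≡ 1ℤ
      φ-ekke = φ-square (*-≢0 (*-≢0 (*-≢0 e≢0 k≢0) k≢0) e≢0) (e * k)
                        (solve 2 (λ e k → (e :* k) :* (e :* k) := e :* k :* k :* e) refl e k)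

    ∑φvw≡ : ∑[ x ] φ (v x * w x) ≡ φ (- (a * e * h)) ℤ.* ℤ.- aq h g ℤ.+ (φ (- (h * g)) ℤ.* ℤ.- aq (4# * h′) g′ ℤ.- 1ℤ)
    ∑φvw≡ = begin
      ∑[ x ] φ (v x * w x)                     ≡⟨ ∑-cong (λ x → cong φ (v*w≡Q[x²] d e k a x)) ⟩
      ∑[ x ] φ (Q (x * x))                     ≡⟨ ∑φ-even Q ⟩
      ∑[ t ] φ (Q t) ℤ.+ ∑[ t ] φ (t * Q t)    ≡⟨ cong₂ ℤ._+_ ∑φ-Q ∑φ-tQ ⟩
      φ (- (a * e * h)) ℤ.* ℤ.- aq h g ℤ.+ (φ (- (h * g)) ℤ.* ℤ.- aq (4# * h′) g′ ℤ.- 1ℤ)  ∎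
      where
      v*w≡Q[x²] : ∀ d e k a x → (d - e * k * k * (x * x * x * x)) * (a - e * x * x)
                                ≡ (d - e * k * k * ((x * x) * (x * x))) * (a - e * (x * x))
      v*w≡Q[x²] = solve 5 (λ d e k a x → (d :- e :* k :* k :* (x :* x :* x :* x)) :* (a :- e :* x :* x)
                                        := (d :- e :* k :* k :* ((x :* x) :* (x :* x))) :* (a :- e :* (x :* x))) refl

corollary1p11 :
    (K : FiniteField) (p r : ℕ) → Prime p → p % 2 ≡ 1 → 1 ≤ r →
    FiniteField.size K ≡ p ^ r →
    let open FiniteField K
        open Ops K
    in (a b c d e f : F) →
       ¬ (a ≡ 0#) → ¬ (b ≡ 0#) → ¬ (c ≡ 0#) → ¬ (d ≡ 0#) → ¬ (e ≡ 0#) → ¬ (f ≡ 0#) →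
       a * f ≡ c * e →
       c * c - 4# * a * b ≡ 0# →
       (h g : F) → ¬ (h ≡ 0#) → ¬ (g ≡ 0#) →
       c * c * g ≡ h * h * d * e →
       + #C a b c d e f
         ≡ (+ size) ℤ.- 1ℤ
           ℤ.- φ (- (a * e * h)) ℤ.* aq h g
           ℤ.- φ (- (h * g)) ℤ.* aq (4# * h ⁻¹) (g ⁻¹)
           ℤ.+ ((+ size) ℤ.* δ (1# - a * b * (d * e) ⁻¹) ℤ.- 1ℤ) ℤ.* (1ℤ ℤ.+ φ (a * e))
-- c ≠ 0 and c² = 4ab already force the characteristic to be odd.
corollary1p11 K _ _ _ _ _ _ a b c d e f a≢0 _ c≢0 d≢0 e≢0 _ af≡ce c²-4ab≡0 h g h≢0 g≢0 c²g≡h²de = begin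
  + #C a b c d e f                                        ≡⟨ #C≡ ⟩
  N ℤ.* (q ℤ.* δ D) ℤ.+ (q ℤ.- N ℤ.+ ∑[ x ] φ (v x * w x)) ≡⟨ cong (λ S → N ℤ.* (q ℤ.* δ D) ℤ.+ (q ℤ.- N ℤ.+ S)) ∑φvw≡ ⟩
  N ℤ.* (q ℤ.* δ D) ℤ.+ (q ℤ.- N ℤ.+ (φ₁ ℤ.* ℤ.- a₁ ℤ.+ (φ₂ ℤ.* ℤ.- a₂ ℤ.- 1ℤ)))
    ≡⟨ rearrange q (δ D) N φ₁ a₁ φ₂ a₂ ⟩
  q ℤ.- 1ℤ ℤ.- φ₁ ℤ.* a₁ ℤ.- φ₂ ℤ.* a₂ ℤ.+ (q ℤ.* δ D ℤ.- 1ℤ) ℤ.* N  ∎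
  where
  open FiniteField K
  open Ops K
  open FieldSums K using (∑)
  open PointCount.Curve K a≢0 c≢0 d≢0 e≢0 h≢0 g≢0 af≡ce c²-4ab≡0 c²g≡h²de
  open ≡-Reasoning
  q N φ₁ φ₂ a₁ a₂ : ℤ
  q = + size
  N = 1ℤ ℤ.+ φ (a * e)
  φ₁ = φ (- (a * e * h))
  φ₂ = φ (- (h * g))
  a₁ = aq h g
  a₂ = aq (4# * h ⁻¹) (g ⁻¹)
  rearrange : ∀ q δ N φ₁ a₁ φ₂ a₂ →
              N ℤ.* (q ℤ.* δ) ℤ.+ (q ℤ.- N ℤ.+ (φ₁ ℤ.* ℤ.- a₁ ℤ.+ (φ₂ ℤ.* ℤ.- a₂ ℤ.- 1ℤ)))
              ≡ q ℤ.- 1ℤ ℤ.- φ₁ ℤ.* a₁ ℤ.- φ₂ ℤ.* a₂ ℤ.+ (q ℤ.* δ ℤ.- 1ℤ) ℤ.* N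
  rearrange = solve-∀
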